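{- Suppose $M(A)$ and $N(B)$ are matched. Let $L=M\mathbin{\Join} N$, $E=A\cup B$, $S=A-B$, and $r=r(L)=r_M(S)+r(N)$. Then: (1) $\mathcal I(L)=\{X\subseteq E: X\cap A\in\mathcal I(M)\text{ and }|X|\le r_M(S)+r_N(X\cap B)\}$. (2) $\mathcal S(L)=\{X\subseteq E: X\cap B\in\mathcal S(N)\text{ and }r_M(X\cap A)+|X-A|\ge r\}$. (3) $\mathcal B(L)=\{X\subseteq E: |X|=r,\ X\cap A\in\mathcal I(M),\ X\cap B\in\mathcal S(N)\}$. (4) $\mathcal C(L)=\mathcal C(M)\cup\mathcal C$, where $\mathcal C$ is the set of all $X\subseteq E$ such that $X\cap A\in\mathcal I(M)$, $N|(X\cap B)$ has no isthmuses, and $r_N(X\cap B)=|X|-r_M(S)-1$. (5) For all $X\subseteq E$, $\mathrm{cl}_L(X)=\mathrm{cl}_M(X\cap A)\cup X$ if $r_M(X\cap A)+|X-A|<r_M(S)+r_N(X\cap B)$, and $\mathrm{cl}_L(X)=\mathrm{cl}_N(X\cap B)\cup S$ otherwise. (6) $\mathcal F(L)=\mathcal F_1\cup\mathcal F_2$, where $\mathcal F_2=\{S\cup F: F\in\mathcal F(N)\}$ and $\mathcal F_1=\{X\subseteq E: X\cap A\in\mathcal F(M)\text{ and }r_M(X\cap A)+|X-A|<r_M(S)+r_N(X\cap B)\}$. (7) $\mathcal Z(L)=\mathcal Z_1\cup\mathcal Z_2\cup\mathcal Z_3$, where $\mathcal Z_1=\{Z\in\mathcal Z(M): S\not\subseteq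 Z\}$, $\mathcal Z_2=\{Z\in\mathcal Z(M): S\subseteq Z\text{ and }Z\cap B\in\mathcal Z(N)\}$, and $\mathcal Z_3=\{Z\subseteq E: S\subseteq Z\not\subseteq A\text{ and }Z\cap B\in\mathcal Z(N)\}$.
   Context: $M.X$ is contraction of $M$ to $X$ (i.e. $M/(E-X)$), $M|X$ restriction. $M(A)$, $N(B)$ matched means $M.(A\cap B)=N|(A\cap B)$. Free splice $M\mathbin{\Join} N$: matroid on $A\cup B$ with rank $r(X)=\min\{r_M(X\cap A)+|X-A|,\ r_N(X\cap B)+r_M(A-B)\}$. For a matroid $M$: $\mathcal I(M),\mathcal B(M),\mathcal C(M),\mathcal S(M),\mathcal F(M),\mathcal Z(M)$ are the independent sets, bases, circuits, spanning sets, flats and cyclic flats (flats that are unions of circuits); $\mathrm{cl}_M$ is closure and $r(M)$ the rank. -}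

module Defs where

open import Data.Nat using (ℕ; _+_; _∸_; _≤_; _⊓_; _≟_)
open import Data.Bool using (_∧_)
open import Data.Fin using (Fin)
open import Data.Fin.Subset using (Subset; _∈_; _⊆_; _∩_; _∪_; _─_; ∣_∣; ⁅_⁆)
open import Data.Vec using (lookup; tabulate)
open import Data.Product using (Σ; _×_)
open import Relation.Nullary using (¬_; ⌊_⌋)
open import Relation.Binary.PropositionalEquality using (_≡_; _≢_)

-- A "rank system": a ground set E ⊆ Fin n together with a function on
-- subsets of Fin n (only its values on subsets of E matter).
record RankFn (n : ℕ) : Set where
  field
    E : Subset n
    r : Subset n → ℕ
open RankFn public

record Matroid (n : ℕ) : Set where
  field
    rk      : RankFn n
    r-bound : ∀ X → X ⊆ E rk → r rk X ≤ ∣ X ∣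
    r-mono  : ∀ X Y → X ⊆ Y → Y ⊆ E rk → r rk X ≤ r rk Y
    r-sub   : ∀ X Y → X ⊆ E rk → Y ⊆ E rk →
              r rk (X ∪ Y) + r rk (X ∩ Y) ≤ r rk X + r rk Y
open Matroid public

module _ {n : ℕ} (R : RankFn n) where
  Indep : Subset n → Set
  Indep X = X ⊆ E R × r R X ≡ ∣ X ∣

  Basis : Subset n → Set
  Basis X = Indep X × (∀ Y → Indep Y → X ⊆ Y → Y ≡ X)

  Spanning : Subset n → Set
  Spanning X = X ⊆ E R × r R X ≡ r R (E R)

  Circuit : Subset n → Set
  Circuit X = X ⊆ E R × ¬ Indep X × (∀ Y → Y ⊆ X → Y ≢ X → Indep Y)

  -- cl(X) = X ∪ {e ∈ E : r(X ∪ e) = r(X)}  (for X ⊆ E the union with X is redundant)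
  cl : Subset n → Subset n
  cl X = tabulate λ i → lookup (E R) i ∧ ⌊ r R (X ∪ ⁅ i ⁆) ≟ r R X ⌋

  Flat : Subset n → Set
  Flat X = X ⊆ E R × cl X ≡ X

  CyclicFlat : Subset n → Set
  CyclicFlat Z = Flat Z × (∀ e → e ∈ Z → Σ (Subset n) λ C → Circuit C × C ⊆ Z × e ∈ C)

  Isthmus : Fin n → Set
  Isthmus e = e ∈ E R × (∀ X → Basis X → e ∈ X)

  rank : ℕ
  rank = r R (E R)

restrict : ∀ {n} → RankFn n → Subset n → RankFn n
restrict R X = record { E = X ; r = r R }

-- contraction R.X = R/(E - X)  (X ⊆ E)
contractTo : ∀ {n} → RankFn n → Subset n → RankFn n
contractTo R X = record { E = X ; r = λ Y → r R (Y ∪ (E R ─ X)) ∸ r R (E R ─ X) }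

SameMatroid : ∀ {n} → RankFn n → RankFn n → Set
SameMatroid R Q = E R ≡ E Q × (∀ Y → Y ⊆ E R → r R Y ≡ r Q Y)

Matched : ∀ {n} → Matroid n → Matroid n → Set
Matched M N = SameMatroid (contractTo (rk M) (A ∩ B)) (restrict (rk N) (A ∩ B))
  where A = E (rk M) ; B = E (rk N)

NoIsthmus : ∀ {n} → RankFn n → Subset n → Set
NoIsthmus N Y = ∀ e → ¬ Isthmus (restrict N Y) e

splice : ∀ {n} → Matroid n → Matroid n → RankFn n
splice M N = record
  { E = A ∪ B
  ; r = λ X → (r (rk M) (X ∩ A) + ∣ X ─ A ∣) ⊓ (r (rk N) (X ∩ B) + r (rk M) (A ─ B)) }
  where A = E (rk M) ; B = E (rk N)

-- The splice rank is rL = f ⊓ g with f(X) = r_M(X ∩ A) + |X − A| and g(X) = r_M(S) + r_N(X ∩ B).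
-- Matching means r_M(Y ∪ S) = r_N(Y) + r_M(S) for Y ⊆ A ∩ B.  From this, f and g are submodular and
-- satisfy the mixed inequality g(X ∪ Y) + f(X ∩ Y) ≤ f(X) + g(Y), so f ⊓ g is a matroid rank; it agrees
-- with r_M on subsets of A, and it equals g on every set containing S.  Each family of the splice is then
-- read off by comparing f and g: when f(X) < g(X) the set X behaves as in M (through X ∩ A), otherwise as
-- in N (through X ∩ B, with S adjoined).

module Submission where

open import Defs
open import Data.Nat using (ℕ; _+_; _≤_; _<_; _≥_)
open import Data.Fin.Subset using (Subset; _⊆_; _∩_; _∪_; _─_; ∣_∣)
open import Data.Product using (Σ; _×_)
open import Data.Sum using (_⊎_)
open import Function.Bundles using (_⇔_)
open import Relation.Nullary using (¬_)
open import Relation.Binary.PropositionalEquality using (_≡_)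

open import Data.Bool using (Bool; true; false; _∧_; _∨_; not)
open import Data.Bool.Properties using (∧-zeroʳ; ∧-identityʳ) renaming (_≟_ to _≟ᵇ_)
open import Data.Fin using (Fin; zero; suc)
open import Data.Fin.Properties using (all?; ¬∀⟶∃¬)
open import Data.Fin.Subset
open import Data.Fin.Subset.Induction using (⊂-wellFounded; ⊃-wellFounded)
open import Data.Fin.Subset.Properties
open import Data.Nat using (zero; suc; _∸_; _⊓_; _≟_; _≤?_; _<?_; s≤s; z≤n)
open import Data.Nat.Properties
open import Data.Nat.Tactic.RingSolver using (solve-∀)
open import Algebra.Properties.CommutativeSemigroup +-commutativeSemigroup using (interchange; xy∙z≈y∙xz)
open import Data.Product using (∃; _,_; proj₁; proj₂)
open import Data.Sum using (inj₁; inj₂; [_,_]′)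
open import Data.Vec using (Vec; []; _∷_; lookup; map; tabulate; here; there)
open import Data.Vec.Properties
  using (lookup-zipWith; lookup-map; lookup∘tabulate; tabulate∘lookup; tabulate-cong; []=⇒lookup; lookup⇒[]=)
open import Function using (_∘_)
open import Function.Bundles using (mk⇔; module Equivalence)
open import Induction.WellFounded using (Acc; acc)
open import Relation.Binary.PropositionalEquality hiding ([_])
open import Relation.Nullary using (Dec; yes; no; does; _×-dec_)
open import Relation.Nullary.Decidable using (_→-dec_; dec-true; isYes≗does)
open import Relation.Nullary.Negation using (contradiction)
open import Relation.Unary using (Decidable)

private variable
  n : ℕ
  p q u : Subset n
  x : Fin n

module BooleanIdentity where

  infixr 7 _∩ᵉ_
  infixr 6 _∪ᵉ_
  infixl 5 _─ᵉ_

  data SetExpr (k : ℕ) : Set where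
    var : Fin k → SetExpr k
    _∩ᵉ_ _∪ᵉ_ _─ᵉ_ : SetExpr k → SetExpr k → SetExpr k

  ⟦_⟧ : ∀ {k} → SetExpr k → Vec (Subset n) k → Subset n
  ⟦ var i ⟧ ρ = lookup ρ i
  ⟦ a ∩ᵉ b ⟧ ρ = ⟦ a ⟧ ρ ∩ ⟦ b ⟧ ρ
  ⟦ a ∪ᵉ b ⟧ ρ = ⟦ a ⟧ ρ ∪ ⟦ b ⟧ ρ
  ⟦ a ─ᵉ b ⟧ ρ = ⟦ a ⟧ ρ ─ ⟦ b ⟧ ρ

  ⟦_⟧ᵇ : ∀ {k} → SetExpr k → Vec Bool k → Bool
  ⟦ var i ⟧ᵇ σ = lookup σ i
  ⟦ a ∩ᵉ b ⟧ᵇ σ = ⟦ a ⟧ᵇ σ ∧ ⟦ b ⟧ᵇ σ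
  ⟦ a ∪ᵉ b ⟧ᵇ σ = ⟦ a ⟧ᵇ σ ∨ ⟦ b ⟧ᵇ σ
  ⟦ a ─ᵉ b ⟧ᵇ σ = ⟦ a ⟧ᵇ σ ∧ not (⟦ b ⟧ᵇ σ)

  lookup-─ : ∀ (p q : Subset n) i → lookup (p ─ q) i ≡ lookup p i ∧ not (lookup q i)
  lookup-─ (x ∷ p) (inside ∷ q) zero = sym (∧-zeroʳ x)
  lookup-─ (x ∷ p) (outside ∷ q) zero = sym (∧-identityʳ x)
  lookup-─ (x ∷ p) (y ∷ q) (suc i) = lookup-─ p q i

  lookup-⟦⟧ : ∀ {k} (a : SetExpr k) (ρ : Vec (Subset n) k) i →
              lookup (⟦ a ⟧ ρ) i ≡ ⟦ a ⟧ᵇ (map (λ p → lookup p i) ρ)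
  lookup-⟦⟧ (var j) ρ i = sym (lookup-map j (λ p → lookup p i) ρ)
  lookup-⟦⟧ (a ∩ᵉ b) ρ i =
    trans (lookup-zipWith _∧_ i (⟦ a ⟧ ρ) (⟦ b ⟧ ρ)) (cong₂ _∧_ (lookup-⟦⟧ a ρ i) (lookup-⟦⟧ b ρ i))
  lookup-⟦⟧ (a ∪ᵉ b) ρ i =
    trans (lookup-zipWith _∨_ i (⟦ a ⟧ ρ) (⟦ b ⟧ ρ)) (cong₂ _∨_ (lookup-⟦⟧ a ρ i) (lookup-⟦⟧ b ρ i))
  lookup-⟦⟧ (a ─ᵉ b) ρ i =
    trans (lookup-─ (⟦ a ⟧ ρ) (⟦ b ⟧ ρ) i) (cong₂ (λ u v → u ∧ not v) (lookup-⟦⟧ a ρ i) (lookup-⟦⟧ b ρ i))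

  everyRow : ∀ k → (Vec Bool k → Bool) → Bool
  everyRow zero P = P []
  everyRow (suc k) P = everyRow k (P ∘ (true ∷_)) ∧ everyRow k (P ∘ (false ∷_))

  everyRow-sound : ∀ k P → everyRow k P ≡ true → ∀ σ → P σ ≡ true
  everyRow-sound zero P holds [] = holds
  everyRow-sound (suc k) P holds (b ∷ σ) with everyRow k (P ∘ (true ∷_)) in ≡t | b
  ... | true | true = everyRow-sound k _ ≡t σ
  ... | true | false = everyRow-sound k _ holds σ

  _≐_ : ∀ {k} → SetExpr k → SetExpr k → Bool
  _≐_ {k} a b = everyRow k (λ σ → does (⟦ a ⟧ᵇ σ ≟ᵇ ⟦ b ⟧ᵇ σ))

  ≐-sound : ∀ {k} (a b : SetExpr k) → a ≐ b ≡ true → ∀ σ → ⟦ a ⟧ᵇ σ ≡ ⟦ b ⟧ᵇ σ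
  ≐-sound {k} a b holds σ with ⟦ a ⟧ᵇ σ ≟ᵇ ⟦ b ⟧ᵇ σ | everyRow-sound k _ holds σ
  ... | yes a≡b | _ = a≡b

  set-≡ : ∀ {k} (a b : SetExpr k) → a ≐ b ≡ true → (ρ : Vec (Subset n) k) → ⟦ a ⟧ ρ ≡ ⟦ b ⟧ ρ
  set-≡ a b holds ρ = begin
    ⟦ a ⟧ ρ                              ≡⟨ tabulate∘lookup _ ⟨
    tabulate (lookup (⟦ a ⟧ ρ))          ≡⟨ tabulate-cong pointwise ⟩
    tabulate (lookup (⟦ b ⟧ ρ))          ≡⟨ tabulate∘lookup _ ⟩
    ⟦ b ⟧ ρ                              ∎
    where
    open ≡-Reasoning
    pointwise : ∀ i → lookup (⟦ a ⟧ ρ) i ≡ lookup (⟦ b ⟧ ρ) i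
    pointwise i = trans (lookup-⟦⟧ a ρ i) (trans (≐-sound a b holds _) (sym (lookup-⟦⟧ b ρ i)))

  set-⊆ : ∀ {k} (a b : SetExpr k) → (a ∩ᵉ b) ≐ a ≡ true → (ρ : Vec (Subset n) k) → ⟦ a ⟧ ρ ⊆ ⟦ b ⟧ ρ
  set-⊆ a b holds ρ x∈a =
    proj₂ (x∈p∩q⁻ (⟦ a ⟧ ρ) _ (subst (_ ∈_) (sym (set-≡ (a ∩ᵉ b) a holds ρ)) x∈a))

  v₀ : ∀ {k} → SetExpr (suc k)
  v₀ = var zero
  v₁ : ∀ {k} → SetExpr (2 + k)
  v₁ = var (suc zero)
  v₂ : ∀ {k} → SetExpr (3 + k)
  v₂ = var (suc (suc zero))
  v₃ : ∀ {k} → SetExpr (4 + k)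
  v₃ = var (suc (suc (suc zero)))

open BooleanIdentity

x∈q⇒x∉p─q : ∀ (p q : Subset n) → x ∈ q → x ∉ p ─ q
x∈q⇒x∉p─q (_ ∷ p) (inside ∷ q) here ()
x∈q⇒x∉p─q (_ ∷ p) (_ ∷ q) (there x∈q) (there x∈p─q) = x∈q⇒x∉p─q p q x∈q x∈p─q

x∈p─q⁻ : ∀ (p q : Subset n) → x ∈ p ─ q → x ∈ p × x ∉ q
x∈p─q⁻ p q x∈p─q = p─q⊆p p q x∈p─q , λ x∈q → x∈q⇒x∉p─q p q x∈q x∈p─q

∪-lub : p ⊆ u → q ⊆ u → p ∪ q ⊆ u
∪-lub {p = p} {q = q} p⊆u q⊆u x∈p∪q = [ p⊆u , q⊆u ]′ (x∈p∪q⁻ p q x∈p∪q)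

∩-glb : u ⊆ p → u ⊆ q → u ⊆ p ∩ q
∩-glb u⊆p u⊆q x∈u = x∈p∩q⁺ (u⊆p x∈u , u⊆q x∈u)

x∈p⇒⁅x⁆⊆p : x ∈ p → ⁅ x ⁆ ⊆ p
x∈p⇒⁅x⁆⊆p {x = x} x∈p y∈⁅x⁆ = subst (_∈ _) (sym (x∈⁅y⁆⇒x≡y x y∈⁅x⁆)) x∈p

x∉p-x : x ∉ p - x
x∉p-x {x = x} {p = p} x∈p-x = proj₂ (x∈p─q⁻ p ⁅ x ⁆ x∈p-x) (x∈⁅x⁆ x)

∀∈-or-∃∈¬ : ∀ (p : Subset n) {P : Fin n → Set} → Decidable P →
            (∀ x → x ∈ p → P x) ⊎ ∃ λ x → x ∈ p × ¬ P x
∀∈-or-∃∈¬ {n} p P? with all? (λ x → (x ∈? p) →-dec P? x)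
... | yes all = inj₁ all
... | no ¬all with ¬∀⟶∃¬ n _ (λ x → (x ∈? p) →-dec P? x) ¬all
...   | x , ¬[x∈p⇒Px] with x ∈? p
...     | yes x∈p = inj₂ (x , x∈p , λ Px → ¬[x∈p⇒Px] (λ _ → Px))
...     | no x∉p  = contradiction (λ x∈p → contradiction x∈p x∉p) ¬[x∈p⇒Px]

⊈⇒∃ : ¬ p ⊆ q → ∃ λ x → x ∈ p × x ∉ q
⊈⇒∃ {p = p} {q = q} p⊈q with ∀∈-or-∃∈¬ p (_∈? q)
... | inj₁ p⊆q = contradiction (λ {x} → p⊆q x) p⊈q
... | inj₂ witness = witness

x∈p⇒p∪⁅x⁆≡p : x ∈ p → p ∪ ⁅ x ⁆ ≡ p
x∈p⇒p∪⁅x⁆≡p x∈p = ⊆-antisym (∪-lub ⊆-refl (x∈p⇒⁅x⁆⊆p x∈p)) (p⊆p∪q _)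

x∈p⇒p-x∪⁅x⁆≡p : x ∈ p → (p - x) ∪ ⁅ x ⁆ ≡ p
x∈p⇒p-x∪⁅x⁆≡p {x = x} {p = p} x∈p = ⊆-antisym (∪-lub (p─q⊆p p ⁅ x ⁆) (x∈p⇒⁅x⁆⊆p x∈p)) p⊆p-x∪⁅x⁆
  where
  p⊆p-x∪⁅x⁆ : p ⊆ (p - x) ∪ ⁅ x ⁆
  p⊆p-x∪⁅x⁆ {y} y∈p with y ∈? ⁅ x ⁆
  ... | yes y∈⁅x⁆ = q⊆p∪q _ _ y∈⁅x⁆
  ... | no y∉⁅x⁆ = p⊆p∪q _ (x∈p∧x∉q⇒x∈p─q y∈p y∉⁅x⁆)

p⊆q∪[p─q] : ∀ (p q : Subset n) → p ⊆ q ∪ (p ─ q)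
p⊆q∪[p─q] p q {x} x∈p with x ∈? q
... | yes x∈q = p⊆p∪q _ x∈q
... | no x∉q = q⊆p∪q q _ (x∈p∧x∉q⇒x∈p─q x∈p x∉q)

p⊆q⇒p─r⊆q─r : ∀ {p q} (r : Subset n) → p ⊆ q → p ─ r ⊆ q ─ r
p⊆q⇒p─r⊆q─r {p = p} r p⊆q x∈p─r with x∈p─q⁻ p r x∈p─r
... | x∈p , x∉r = x∈p∧x∉q⇒x∈p─q (p⊆q x∈p) x∉r

p⊆q∧x∉p⇒p⊆q-x : p ⊆ q → x ∉ p → p ⊆ q - x
p⊆q∧x∉p⇒p⊆q-x {x = x} p⊆q x∉p y∈p =
  x∈p∧x∉q⇒x∈p─q (p⊆q y∈p) (λ y∈⁅x⁆ → x∉p (subst (_∈ _) (x∈⁅y⁆⇒x≡y x y∈⁅x⁆) y∈p))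

p⊆q∪⁅x⁆∧x∉p⇒p⊆q : p ⊆ q ∪ ⁅ x ⁆ → x ∉ p → p ⊆ q
p⊆q∪⁅x⁆∧x∉p⇒p⊆q {q = q} {x = x} p⊆q∪⁅x⁆ x∉p {y} y∈p with x∈p∪q⁻ q ⁅ x ⁆ (p⊆q∪⁅x⁆ y∈p)
... | inj₁ y∈q = y∈q
... | inj₂ y∈⁅x⁆ = contradiction (subst (_∈ _) (x∈⁅y⁆⇒x≡y x y∈⁅x⁆) y∈p) x∉p

p⊆q⇒p∩r⊆q∩r : ∀ {p q} (r : Subset n) → p ⊆ q → p ∩ r ⊆ q ∩ r
p⊆q⇒p∩r⊆q∩r {p = p} r p⊆q x∈p∩r with x∈p∩q⁻ p r x∈p∩r
... | x∈p , x∈r = x∈p∩q⁺ (p⊆q x∈p , x∈r)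

p⊆q⇒p∩q≡p : p ⊆ q → p ∩ q ≡ p
p⊆q⇒p∩q≡p {p = p} {q = q} p⊆q = ⊆-antisym (p∩q⊆p p q) (∩-glb ⊆-refl p⊆q)

p⊆q⇒∣p─q∣≡0 : p ⊆ q → ∣ p ─ q ∣ ≡ 0
p⊆q⇒∣p─q∣≡0 {n} {p = p} {q = q} p⊆q = trans (cong ∣_∣ (Empty-unique p─q-empty)) (∣⊥∣≡0 n)
  where
  p─q-empty : Empty (p ─ q)
  p─q-empty (x , x∈p─q) with x∈p─q⁻ p q x∈p─q
  ... | x∈p , x∉q = x∉q (p⊆q x∈p)

x∈p∪q∧x∉q⇒x∈p : ∀ (p q : Subset n) → x ∈ p ∪ q → x ∉ q → x ∈ p
x∈p∪q∧x∉q⇒x∈p p q x∈p∪q x∉q with x∈p∪q⁻ p q x∈p∪q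
... | inj₁ x∈p = x∈p
... | inj₂ x∈q = contradiction x∈q x∉q

p⊆q∪r⇒p─q⊆r : ∀ (q r : Subset n) → p ⊆ q ∪ r → p ─ q ⊆ r
p⊆q∪r⇒p─q⊆r {p = p} q r p⊆q∪r x∈p─q with x∈p─q⁻ p q x∈p─q
... | x∈p , x∉q with x∈p∪q⁻ q r (p⊆q∪r x∈p)
...   | inj₁ x∈q = contradiction x∈q x∉q
...   | inj₂ x∈r = x∈r

∣p∣≡∣p∩q∣+∣p─q∣ : ∀ (p q : Subset n) → ∣ p ∣ ≡ ∣ p ∩ q ∣ + ∣ p ─ q ∣
∣p∣≡∣p∩q∣+∣p─q∣ [] [] = refl
∣p∣≡∣p∩q∣+∣p─q∣ (inside ∷ p) (inside ∷ q) = cong suc (∣p∣≡∣p∩q∣+∣p─q∣ p q)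
∣p∣≡∣p∩q∣+∣p─q∣ (inside ∷ p) (outside ∷ q) = trans (cong suc (∣p∣≡∣p∩q∣+∣p─q∣ p q)) (sym (+-suc _ _))
∣p∣≡∣p∩q∣+∣p─q∣ (outside ∷ p) (inside ∷ q) = ∣p∣≡∣p∩q∣+∣p─q∣ p q
∣p∣≡∣p∩q∣+∣p─q∣ (outside ∷ p) (outside ∷ q) = ∣p∣≡∣p∩q∣+∣p─q∣ p q

∣p∪q∣+∣p∩q∣≡∣p∣+∣q∣ : ∀ (p q : Subset n) → ∣ p ∪ q ∣ + ∣ p ∩ q ∣ ≡ ∣ p ∣ + ∣ q ∣
∣p∪q∣+∣p∩q∣≡∣p∣+∣q∣ [] [] = refl
∣p∪q∣+∣p∩q∣≡∣p∣+∣q∣ (inside ∷ p) (inside ∷ q) =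
  cong suc (trans (+-suc _ _) (trans (cong suc (∣p∪q∣+∣p∩q∣≡∣p∣+∣q∣ p q)) (sym (+-suc _ _))))
∣p∪q∣+∣p∩q∣≡∣p∣+∣q∣ (inside ∷ p) (outside ∷ q) = cong suc (∣p∪q∣+∣p∩q∣≡∣p∣+∣q∣ p q)
∣p∪q∣+∣p∩q∣≡∣p∣+∣q∣ (outside ∷ p) (inside ∷ q) = trans (cong suc (∣p∪q∣+∣p∩q∣≡∣p∣+∣q∣ p q)) (sym (+-suc _ _))
∣p∪q∣+∣p∩q∣≡∣p∣+∣q∣ (outside ∷ p) (outside ∷ q) = ∣p∪q∣+∣p∩q∣≡∣p∣+∣q∣ p q

x∉p⇒∣p∪⁅x⁆∣≡1+∣p∣ : x ∉ p → ∣ p ∪ ⁅ x ⁆ ∣ ≡ suc ∣ p ∣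
x∉p⇒∣p∪⁅x⁆∣≡1+∣p∣ {x = zero} {p = inside ∷ p} x∉p = contradiction here x∉p
x∉p⇒∣p∪⁅x⁆∣≡1+∣p∣ {x = zero} {p = outside ∷ p} x∉p = cong (suc ∘ ∣_∣) (∪-identityʳ p)
x∉p⇒∣p∪⁅x⁆∣≡1+∣p∣ {x = suc x} {p = inside ∷ p} x∉p = cong suc (x∉p⇒∣p∪⁅x⁆∣≡1+∣p∣ (x∉p ∘ there))
x∉p⇒∣p∪⁅x⁆∣≡1+∣p∣ {x = suc x} {p = outside ∷ p} x∉p = x∉p⇒∣p∪⁅x⁆∣≡1+∣p∣ (x∉p ∘ there)

x∈p⇒∣p∣≡1+∣p-x∣ : ∀ (p : Subset n) → x ∈ p → ∣ p ∣ ≡ suc ∣ p - x ∣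
x∈p⇒∣p∣≡1+∣p-x∣ (inside ∷ p) here = cong (suc ∘ ∣_∣) (sym (p─⊥≡p p))
x∈p⇒∣p∣≡1+∣p-x∣ (inside ∷ p) (there x∈p) = cong suc (x∈p⇒∣p∣≡1+∣p-x∣ p x∈p)
x∈p⇒∣p∣≡1+∣p-x∣ (outside ∷ p) (there x∈p) = x∈p⇒∣p∣≡1+∣p-x∣ p x∈p

p⊆q∧∣q∣≤∣p∣⇒p≡q : p ⊆ q → ∣ q ∣ ≤ ∣ p ∣ → p ≡ q
p⊆q∧∣q∣≤∣p∣⇒p≡q {p = p} {q = q} p⊆q ∣q∣≤∣p∣ = ⊆-antisym p⊆q q⊆p
  where
  q⊆p : q ⊆ p
  q⊆p {x} x∈q with x ∈? p
  ... | yes x∈p = x∈p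
  ... | no x∉p = contradiction (≤-trans (p⊂q⇒∣p∣<∣q∣ (p⊆q , x , x∈q , x∉p)) ∣q∣≤∣p∣) (<-irrefl refl)

∣[p∪q]─r∣+∣[p∩q]─r∣≡∣p─r∣+∣q─r∣ : ∀ (p q r : Subset n) → ∣ (p ∪ q) ─ r ∣ + ∣ (p ∩ q) ─ r ∣ ≡ ∣ p ─ r ∣ + ∣ q ─ r ∣
∣[p∪q]─r∣+∣[p∩q]─r∣≡∣p─r∣+∣q─r∣ p q r =
  subst₂ (λ u v → ∣ u ∣ + ∣ v ∣ ≡ ∣ p ─ r ∣ + ∣ q ─ r ∣)
    (set-≡ ((v₀ ─ᵉ v₂) ∪ᵉ (v₁ ─ᵉ v₂)) ((v₀ ∪ᵉ v₁) ─ᵉ v₂) refl (p ∷ q ∷ r ∷ []))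
    (set-≡ ((v₀ ─ᵉ v₂) ∩ᵉ (v₁ ─ᵉ v₂)) ((v₀ ∩ᵉ v₁) ─ᵉ v₂) refl (p ∷ q ∷ r ∷ []))
    (∣p∪q∣+∣p∩q∣≡∣p∣+∣q∣ (p ─ r) (q ─ r))

∣p─r∣≡∣[p∩q]─r∣+∣[p─q]─r∣ : ∀ (p q r : Subset n) → ∣ p ─ r ∣ ≡ ∣ (p ∩ q) ─ r ∣ + ∣ (p ─ q) ─ r ∣
∣p─r∣≡∣[p∩q]─r∣+∣[p─q]─r∣ p q r =
  trans (∣p∣≡∣p∩q∣+∣p─q∣ (p ─ r) q)
        (cong₂ (λ u v → ∣ u ∣ + ∣ v ∣) (set-≡ ((v₀ ─ᵉ v₂) ∩ᵉ v₁) ((v₀ ∩ᵉ v₁) ─ᵉ v₂) refl (p ∷ q ∷ r ∷ []))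
                                       (set-≡ ((v₀ ─ᵉ v₂) ─ᵉ v₁) ((v₀ ─ᵉ v₁) ─ᵉ v₂) refl (p ∷ q ∷ r ∷ [])))

[p∪q]∪u≡[p∪u]∪q : ∀ (p q u : Subset n) → (p ∪ q) ∪ u ≡ (p ∪ u) ∪ q
[p∪q]∪u≡[p∪u]∪q p q u = set-≡ ((v₀ ∪ᵉ v₁) ∪ᵉ v₂) ((v₀ ∪ᵉ v₂) ∪ᵉ v₁) refl (p ∷ q ∷ u ∷ [])

disjoint⇒p─q≡p : ∀ (p : Subset n) → (∀ {x} → x ∈ p → x ∉ q) → p ─ q ≡ p
disjoint⇒p─q≡p p disjoint = ⊆-antisym (p─q⊆p p _) (λ x∈p → x∈p∧x∉q⇒x∈p─q x∈p (disjoint x∈p))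

x∉p⇒p-x≡p : x ∉ p → p - x ≡ p
x∉p⇒p-x≡p {x = x} {p = p} x∉p = disjoint⇒p─q≡p p λ y∈p y∈⁅x⁆ → x∉p (subst (_∈ p) (x∈⁅y⁆⇒x≡y x y∈⁅x⁆) y∈p)

x∉q⇒⁅x⁆─q≡⁅x⁆ : x ∉ q → ⁅ x ⁆ ─ q ≡ ⁅ x ⁆
x∉q⇒⁅x⁆─q≡⁅x⁆ {x = x} {q = q} x∉q = disjoint⇒p─q≡p ⁅ x ⁆ λ y∈⁅x⁆ y∈q → x∉q (subst (_∈ q) (x∈⁅y⁆⇒x≡y x y∈⁅x⁆) y∈q)

module _ (p q : Subset n) where

  x∈q⇒[p∪⁅x⁆]∩q≡p∩q∪⁅x⁆ : x ∈ q → (p ∪ ⁅ x ⁆) ∩ q ≡ p ∩ q ∪ ⁅ x ⁆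
  x∈q⇒[p∪⁅x⁆]∩q≡p∩q∪⁅x⁆ {x} x∈q =
    trans (∩-distribʳ-∪ q p ⁅ x ⁆) (cong (p ∩ q ∪_) (p⊆q⇒p∩q≡p (x∈p⇒⁅x⁆⊆p x∈q)))

  x∈q⇒[p∪⁅x⁆]─q≡p─q : x ∈ q → (p ∪ ⁅ x ⁆) ─ q ≡ p ─ q
  x∈q⇒[p∪⁅x⁆]─q≡p─q {x} x∈q = begin
    (p ∪ ⁅ x ⁆) ─ q       ≡⟨ cong (λ t → (p ∪ t) ─ q) (p⊆q⇒p∩q≡p (x∈p⇒⁅x⁆⊆p x∈q)) ⟨
    (p ∪ ⁅ x ⁆ ∩ q) ─ q   ≡⟨ set-≡ ((v₀ ∪ᵉ v₁ ∩ᵉ v₂) ─ᵉ v₂) (v₀ ─ᵉ v₂) refl (p ∷ ⁅ x ⁆ ∷ q ∷ []) ⟩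
    p ─ q                 ∎
    where open ≡-Reasoning

  x∉q⇒[p∪⁅x⁆]∩q≡p∩q : x ∉ q → (p ∪ ⁅ x ⁆) ∩ q ≡ p ∩ q
  x∉q⇒[p∪⁅x⁆]∩q≡p∩q {x} x∉q = begin
    (p ∪ ⁅ x ⁆) ∩ q       ≡⟨ cong (λ t → (p ∪ t) ∩ q) (x∉q⇒⁅x⁆─q≡⁅x⁆ x∉q) ⟨
    (p ∪ (⁅ x ⁆ ─ q)) ∩ q ≡⟨ set-≡ ((v₀ ∪ᵉ (v₁ ─ᵉ v₂)) ∩ᵉ v₂) (v₀ ∩ᵉ v₂) refl (p ∷ ⁅ x ⁆ ∷ q ∷ []) ⟩
    p ∩ q                 ∎
    where open ≡-Reasoning

  x∉q⇒[p∪⁅x⁆]─q≡[p─q]∪⁅x⁆ : x ∉ q → (p ∪ ⁅ x ⁆) ─ q ≡ (p ─ q) ∪ ⁅ x ⁆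
  x∉q⇒[p∪⁅x⁆]─q≡[p─q]∪⁅x⁆ {x} x∉q = begin
    (p ∪ ⁅ x ⁆) ─ q           ≡⟨ set-≡ ((v₀ ∪ᵉ v₁) ─ᵉ v₂) ((v₀ ─ᵉ v₂) ∪ᵉ (v₁ ─ᵉ v₂)) refl (p ∷ ⁅ x ⁆ ∷ q ∷ []) ⟩
    (p ─ q) ∪ (⁅ x ⁆ ─ q)     ≡⟨ cong ((p ─ q) ∪_) (x∉q⇒⁅x⁆─q≡⁅x⁆ x∉q) ⟩
    (p ─ q) ∪ ⁅ x ⁆           ∎
    where open ≡-Reasoning

Spans : RankFn n → Subset n → Fin n → Set
Spans R X e = r R (X ∪ ⁅ e ⁆) ≡ r R X

Cyclic : RankFn n → Subset n → Set
Cyclic R Z = ∀ e → e ∈ Z → r R (Z - e) ≡ r R Z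

∈cl⁻ : ∀ (R : RankFn n) X {e} → e ∈ cl R X → e ∈ E R × Spans R X e
∈cl⁻ R X {e} e∈cl
  with lookup (E R) e in e∈E | r R (X ∪ ⁅ e ⁆) ≟ r R X | trans (sym (lookup∘tabulate _ e)) ([]=⇒lookup e∈cl)
... | true | yes spans | _ = lookup⇒[]= e (E R) e∈E , spans
... | true | no _ | ()
... | false | _ | ()

∈cl⁺ : ∀ (R : RankFn n) X {e} → e ∈ E R → Spans R X e → e ∈ cl R X
∈cl⁺ R X {e} e∈E spans = lookup⇒[]= e (cl R X)
  (trans (lookup∘tabulate _ e) (cong₂ _∧_ ([]=⇒lookup e∈E) (trans (isYes≗does spans?) (dec-true spans? spans))))
  where
  spans? : Dec (Spans R X e)
  spans? = r R (X ∪ ⁅ e ⁆) ≟ r R X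

⊆-cl : ∀ (R : RankFn n) {X} → X ⊆ E R → X ⊆ cl R X
⊆-cl R {X} X⊆E x∈X = ∈cl⁺ R X (X⊆E x∈X) (cong (r R) (x∈p⇒p∪⁅x⁆≡p x∈X))

cl⊆E : ∀ (R : RankFn n) X → cl R X ⊆ E R
cl⊆E R X = proj₁ ∘ ∈cl⁻ R X

cl⊆⇒flat : ∀ (R : RankFn n) {X} → X ⊆ E R → cl R X ⊆ X → Flat R X
cl⊆⇒flat R X⊆E cl⊆X = X⊆E , ⊆-antisym cl⊆X (⊆-cl R X⊆E)

circuit-del-indep : ∀ {R : RankFn n} {C e} → Circuit R C → e ∈ C → Indep R (C - e)
circuit-del-indep {C = C} {e} (_ , _ , proper-indep) e∈C =
  proper-indep (C - e) (p─q⊆p C ⁅ e ⁆) (λ C-e≡C → x∉p-x (subst (e ∈_) (sym C-e≡C) e∈C))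

module MatroidProperties (M : Matroid n) where

  private
    R : RankFn n
    R = rk M
    ground : Subset n
    ground = E R

  ρ : Subset n → ℕ
  ρ = r R

  ρ-mono : ∀ {X Y} → X ⊆ Y → Y ⊆ ground → ρ X ≤ ρ Y
  ρ-mono {X} {Y} = r-mono M X Y

  ρ-bound : ∀ {X} → X ⊆ ground → ρ X ≤ ∣ X ∣
  ρ-bound {X} = r-bound M X

  ρ-submodular : ∀ {X Y} → X ⊆ ground → Y ⊆ ground → ρ (X ∪ Y) + ρ (X ∩ Y) ≤ ρ X + ρ Y
  ρ-submodular {X} {Y} = r-sub M X Y

  ρ-∪≤ρ+∣∣ : ∀ {X Y} → X ⊆ ground → Y ⊆ ground → ρ (X ∪ Y) ≤ ρ X + ∣ Y ∣
  ρ-∪≤ρ+∣∣ X⊆E Y⊆E =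
    ≤-trans (≤-trans (m≤m+n _ _) (ρ-submodular X⊆E Y⊆E)) (+-monoʳ-≤ _ (ρ-bound Y⊆E))

  ρ-⊥ : ρ ⊥ ≡ 0
  ρ-⊥ = n≤0⇒n≡0 (≤-trans (ρ-bound (⊆-min _)) (≤-reflexive (∣⊥∣≡0 n)))

  ρ∩-mono : ∀ {X Y} → X ⊆ Y → ρ (X ∩ ground) ≤ ρ (Y ∩ ground)
  ρ∩-mono X⊆Y = ρ-mono (p⊆q⇒p∩r⊆q∩r ground X⊆Y) (p∩q⊆q _ ground)

  ρ∩-submodular : ∀ X Y → ρ ((X ∪ Y) ∩ ground) + ρ ((X ∩ Y) ∩ ground) ≤ ρ (X ∩ ground) + ρ (Y ∩ ground)
  ρ∩-submodular X Y =
    subst₂ (λ U V → ρ U + ρ V ≤ ρ (X ∩ ground) + ρ (Y ∩ ground))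
      (set-≡ ((v₀ ∩ᵉ v₂) ∪ᵉ (v₁ ∩ᵉ v₂)) ((v₀ ∪ᵉ v₁) ∩ᵉ v₂) refl (X ∷ Y ∷ ground ∷ []))
      (set-≡ ((v₀ ∩ᵉ v₂) ∩ᵉ (v₁ ∩ᵉ v₂)) ((v₀ ∩ᵉ v₁) ∩ᵉ v₂) refl (X ∷ Y ∷ ground ∷ []))
      (ρ-submodular (p∩q⊆q X ground) (p∩q⊆q Y ground))

  ρ-diminishing-returns : ∀ {P Q T} → P ⊆ Q → Q ⊆ ground → T ⊆ ground →
                          ρ (Q ∪ T) + ρ P ≤ ρ Q + ρ (P ∪ T)
  ρ-diminishing-returns {P} {Q} {T} P⊆Q Q⊆E T⊆E = begin
    ρ (Q ∪ T) + ρ P                   ≤⟨ +-monoʳ-≤ _ (ρ-mono (∩-glb P⊆Q (p⊆p∪q T)) (Q⊆E ∘ p∩q⊆p _ _)) ⟩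
    ρ (Q ∪ T) + ρ (Q ∩ (P ∪ T))       ≡⟨ cong (λ U → ρ U + ρ (Q ∩ (P ∪ T))) Q∪T≡Q∪[P∪T] ⟩
    ρ (Q ∪ (P ∪ T)) + ρ (Q ∩ (P ∪ T)) ≤⟨ ρ-submodular Q⊆E (∪-lub (Q⊆E ∘ P⊆Q) T⊆E) ⟩
    ρ Q + ρ (P ∪ T)                   ∎
    where
    open ≤-Reasoning
    Q∪T≡Q∪[P∪T] : Q ∪ T ≡ Q ∪ (P ∪ T)
    Q∪T≡Q∪[P∪T] = ⊆-antisym (∪-lub (p⊆p∪q _) (q⊆p∪q Q _ ∘ q⊆p∪q P T))
                            (∪-lub (p⊆p∪q T) (∪-lub (p⊆p∪q T ∘ P⊆Q) (q⊆p∪q Q T)))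

  spans-mono : ∀ {Y W e} → Y ⊆ W → W ⊆ ground → e ∈ ground → Spans R Y e → Spans R W e
  spans-mono {Y} {W} {e} Y⊆W W⊆E e∈E Y-spans = ≤-antisym
    (+-cancelʳ-≤ (ρ Y) _ _ (begin
      ρ (W ∪ ⁅ e ⁆) + ρ Y ≤⟨ ρ-diminishing-returns Y⊆W W⊆E (x∈p⇒⁅x⁆⊆p e∈E) ⟩
      ρ W + ρ (Y ∪ ⁅ e ⁆) ≡⟨ cong (ρ W +_) Y-spans ⟩
      ρ W + ρ Y           ∎))
    (ρ-mono (p⊆p∪q _) (∪-lub W⊆E (x∈p⇒⁅x⁆⊆p e∈E)))
    where open ≤-Reasoning

  spans-all⇒ρ≡ : ∀ {Z W} → Z ⊆ W → W ⊆ ground → (∀ e → e ∈ W → Spans R Z e) → ρ W ≡ ρ Z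
  spans-all⇒ρ≡ {Z} {W} Z⊆W W⊆E Z-spans-W =
    trans (cong ρ (sym Z∪W≡W)) (spans-subsets W (⊂-wellFounded W) ⊆-refl)
    where
    Z∪W≡W : Z ∪ W ≡ W
    Z∪W≡W = ⊆-antisym (∪-lub Z⊆W ⊆-refl) (q⊆p∪q Z W)
    spans-subsets : ∀ T → Acc _⊂_ T → T ⊆ W → ρ (Z ∪ T) ≡ ρ Z
    spans-subsets T (acc smaller) T⊆W with nonempty? T
    ... | no T-empty = cong ρ (trans (cong (Z ∪_) (Empty-unique T-empty)) (∪-identityʳ Z))
    ... | yes (t , t∈T) = begin
      ρ (Z ∪ T)                 ≡⟨ cong (λ U → ρ (Z ∪ U)) (x∈p⇒p-x∪⁅x⁆≡p t∈T) ⟨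
      ρ (Z ∪ ((T - t) ∪ ⁅ t ⁆)) ≡⟨ cong ρ (∪-assoc Z (T - t) ⁅ t ⁆) ⟨
      ρ ((Z ∪ (T - t)) ∪ ⁅ t ⁆) ≡⟨ spans-mono (p⊆p∪q _) (∪-lub (W⊆E ∘ Z⊆W) (W⊆E ∘ T-t⊆W))
                                      (W⊆E (T⊆W t∈T)) (Z-spans-W t (T⊆W t∈T)) ⟩
      ρ (Z ∪ (T - t))           ≡⟨ spans-subsets (T - t) (smaller (x∈p⇒p-x⊂p t∈T)) T-t⊆W ⟩
      ρ Z                       ∎
      where
      open ≡-Reasoning
      T-t⊆W : T - t ⊆ W
      T-t⊆W = T⊆W ∘ p─q⊆p T ⁅ t ⁆

  ρ-del≡ρ⇒ρ<ρ+∣─∣ : ∀ {Y Z e} → Y ⊆ ground → Z ⊆ ground → e ∈ Y → e ∉ Z → ρ (Y - e) ≡ ρ Y →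
                     ρ Y < ρ Z + ∣ Y ─ Z ∣
  ρ-del≡ρ⇒ρ<ρ+∣─∣ {Y} {Z} {e} Y⊆E Z⊆E e∈Y e∉Z ρ[Y-e]≡ρY = begin-strict
    ρ Y                           ≡⟨ ρ[Y-e]≡ρY ⟨
    ρ (Y - e)                     ≤⟨ ρ-mono Y-e⊆Z∪[[Y─Z]-e] (∪-lub Z⊆E (Y⊆E ∘ p─q⊆p Y Z ∘ p─q⊆p (Y ─ Z) ⁅ e ⁆)) ⟩
    ρ (Z ∪ ((Y ─ Z) - e))         ≤⟨ ρ-∪≤ρ+∣∣ Z⊆E (Y⊆E ∘ p─q⊆p Y Z ∘ p─q⊆p (Y ─ Z) ⁅ e ⁆) ⟩
    ρ Z + ∣ (Y ─ Z) - e ∣         <⟨ +-monoʳ-< (ρ Z) (n<1+n _) ⟩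
    ρ Z + suc ∣ (Y ─ Z) - e ∣     ≡⟨ cong (ρ Z +_) (x∈p⇒∣p∣≡1+∣p-x∣ (Y ─ Z) (x∈p∧x∉q⇒x∈p─q e∈Y e∉Z)) ⟨
    ρ Z + ∣ Y ─ Z ∣               ∎
    where
    open ≤-Reasoning
    Y-e⊆Z∪[[Y─Z]-e] : Y - e ⊆ Z ∪ ((Y ─ Z) - e)
    Y-e⊆Z∪[[Y─Z]-e] = set-⊆ (v₀ ─ᵉ v₂) (v₁ ∪ᵉ ((v₀ ─ᵉ v₁) ─ᵉ v₂)) refl (Y ∷ Z ∷ ⁅ e ⁆ ∷ [])

  indep? : ∀ X → Dec (Indep R X)
  indep? X = (X ⊆? ground) ×-dec (ρ X ≟ ∣ X ∣)

  indep-⊥ : Indep R ⊥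
  indep-⊥ = ⊆-min ground , trans ρ-⊥ (sym (∣⊥∣≡0 n))

  indep-⊆ : ∀ {Y I} → Y ⊆ I → Indep R I → Indep R Y
  indep-⊆ {Y} {I} Y⊆I (I⊆E , ρI≡∣I∣) = I⊆E ∘ Y⊆I , ≤-antisym (ρ-bound (I⊆E ∘ Y⊆I)) ∣Y∣≤ρY
    where
    open ≤-Reasoning
    ∣Y∣≤ρY : ∣ Y ∣ ≤ ρ Y
    ∣Y∣≤ρY = +-cancelʳ-≤ ∣ I ─ Y ∣ _ _ (begin
      ∣ Y ∣ + ∣ I ─ Y ∣     ≤⟨ +-monoˡ-≤ _ (p⊆q⇒∣p∣≤∣q∣ (∩-glb Y⊆I ⊆-refl)) ⟩
      ∣ I ∩ Y ∣ + ∣ I ─ Y ∣ ≡⟨ ∣p∣≡∣p∩q∣+∣p─q∣ I Y ⟨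
      ∣ I ∣                 ≡⟨ ρI≡∣I∣ ⟨
      ρ I                   ≤⟨ ρ-mono (p⊆q∪[p─q] I Y) (∪-lub (I⊆E ∘ Y⊆I) (I⊆E ∘ p─q⊆p I Y)) ⟩
      ρ (Y ∪ (I ─ Y))       ≤⟨ ρ-∪≤ρ+∣∣ (I⊆E ∘ Y⊆I) (I⊆E ∘ p─q⊆p I Y) ⟩
      ρ Y + ∣ I ─ Y ∣       ∎)

  indep-∪⁅⁆ : ∀ {I e} → Indep R I → e ∈ ground → ¬ Spans R I e → e ∉ I × Indep R (I ∪ ⁅ e ⁆)
  indep-∪⁅⁆ {I} {e} (I⊆E , ρI≡∣I∣) e∈E ¬spans = e∉I , I+e⊆E , ρ≡∣∣
    where
    e∉I : e ∉ I
    e∉I e∈I = ¬spans (cong ρ (x∈p⇒p∪⁅x⁆≡p e∈I))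
    I+e⊆E : I ∪ ⁅ e ⁆ ⊆ ground
    I+e⊆E = ∪-lub I⊆E (x∈p⇒⁅x⁆⊆p e∈E)
    ρ≡∣∣ : ρ (I ∪ ⁅ e ⁆) ≡ ∣ I ∪ ⁅ e ⁆ ∣
    ρ≡∣∣ = begin-equality
      ρ (I ∪ ⁅ e ⁆)    ≡⟨ ≤-antisym
                            (≤-trans (ρ-∪≤ρ+∣∣ I⊆E (x∈p⇒⁅x⁆⊆p e∈E))
                                     (≤-reflexive (trans (cong (ρ I +_) (∣⁅x⁆∣≡1 e)) (+-comm (ρ I) 1))))
                            (≤∧≢⇒< (ρ-mono (p⊆p∪q _) I+e⊆E) (¬spans ∘ sym)) ⟩
      suc (ρ I)        ≡⟨ cong suc ρI≡∣I∣ ⟩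
      suc ∣ I ∣        ≡⟨ x∉p⇒∣p∪⁅x⁆∣≡1+∣p∣ e∉I ⟨
      ∣ I ∪ ⁅ e ⁆ ∣    ∎
      where open ≤-Reasoning

  indep-extends : ∀ {I W} → I ⊆ W → W ⊆ ground → Indep R I →
                  ∃ λ J → Indep R J × I ⊆ J × J ⊆ W × ∣ J ∣ ≡ ρ W
  indep-extends {I} {W} I⊆W W⊆E = extend I (⊃-wellFounded I) I⊆W
    where
    extend : ∀ I → Acc _⊃_ I → I ⊆ W → Indep R I → ∃ λ J → Indep R J × I ⊆ J × J ⊆ W × ∣ J ∣ ≡ ρ W
    extend I (acc larger) I⊆W I-indep with ∀∈-or-∃∈¬ W (λ e → ρ (I ∪ ⁅ e ⁆) ≟ ρ I)
    ... | inj₁ I-spans-W =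
      I , I-indep , ⊆-refl , I⊆W , trans (sym (proj₂ I-indep)) (sym (spans-all⇒ρ≡ I⊆W W⊆E I-spans-W))
    ... | inj₂ (e , e∈W , ¬spans) with indep-∪⁅⁆ I-indep (W⊆E e∈W) ¬spans
    ...   | e∉I , I+e-indep
      with extend (I ∪ ⁅ e ⁆) (larger (p⊆p∪q _ , e , q⊆p∪q I _ (x∈⁅x⁆ e) , e∉I))
                  (∪-lub I⊆W (x∈p⇒⁅x⁆⊆p e∈W)) I+e-indep
    ...     | J , J-indep , I+e⊆J , J⊆W , ∣J∣≡ρW = J , J-indep , I+e⊆J ∘ p⊆p∪q _ , J⊆W , ∣J∣≡ρW

  basis⇔ : ∀ {X} → Basis R X ⇔ (Indep R X × ∣ X ∣ ≡ rank R)
  basis⇔ {X} = mk⇔ to from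
    where
    to : Basis R X → Indep R X × ∣ X ∣ ≡ rank R
    to (X-indep , X-maximal) with indep-extends (proj₁ X-indep) ⊆-refl X-indep
    ... | J , J-indep , X⊆J , _ , ∣J∣≡rank = X-indep , trans (cong ∣_∣ (sym (X-maximal J J-indep X⊆J))) ∣J∣≡rank
    from : Indep R X × ∣ X ∣ ≡ rank R → Basis R X
    from (X-indep , ∣X∣≡rank) = X-indep , λ Y (Y⊆E , ρY≡∣Y∣) X⊆Y →
      sym (p⊆q∧∣q∣≤∣p∣⇒p≡q X⊆Y (≤-trans (≤-reflexive (sym ρY≡∣Y∣))
                                  (≤-trans (ρ-mono Y⊆E ⊆-refl) (≤-reflexive (sym ∣X∣≡rank)))))

  dependent⇒∃circuit⊆ : ∀ {D} → D ⊆ ground → ¬ Indep R D → ∃ λ C → Circuit R C × C ⊆ D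
  dependent⇒∃circuit⊆ {D} = shrink D (⊂-wellFounded D)
    where
    shrink : ∀ D → Acc _⊂_ D → D ⊆ ground → ¬ Indep R D → ∃ λ C → Circuit R C × C ⊆ D
    shrink D (acc smaller) D⊆E D-dep with ∀∈-or-∃∈¬ D (λ e → indep? (D - e))
    ... | inj₁ deletions-indep = D , (D⊆E , D-dep , proper-indep) , ⊆-refl
      where
      proper-indep : ∀ Y → Y ⊆ D → Y ≢ D → Indep R Y
      proper-indep Y Y⊆D Y≢D with ⊈⇒∃ (λ D⊆Y → Y≢D (⊆-antisym Y⊆D D⊆Y))
      ... | e , e∈D , e∉Y = indep-⊆ (p⊆q∧x∉p⇒p⊆q-x Y⊆D e∉Y) (deletions-indep e e∈D)
    ... | inj₂ (e , e∈D , D-e-dep)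
      with shrink (D - e) (smaller (x∈p⇒p-x⊂p e∈D)) (D⊆E ∘ p─q⊆p D ⁅ e ⁆) D-e-dep
    ...   | C , C-circuit , C⊆D-e = C , C-circuit , p─q⊆p D ⁅ e ⁆ ∘ C⊆D-e

  CircuitThrough : Subset n → Fin n → Set
  CircuitThrough Z e = Σ (Subset n) λ C → Circuit R C × C ⊆ Z × e ∈ C

  circuit-spans : ∀ {C e} → Circuit R C → e ∈ C → Spans R (C - e) e
  circuit-spans {C} {e} C-circuit@(C⊆E , C-dep , _) e∈C = begin-equality
    ρ ((C - e) ∪ ⁅ e ⁆) ≡⟨ cong ρ (x∈p⇒p-x∪⁅x⁆≡p e∈C) ⟩
    ρ C                 ≡⟨ ≤-antisym (≤-pred ρC<1+ρ[C-e]) (ρ-mono (p─q⊆p C ⁅ e ⁆) C⊆E) ⟩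
    ρ (C - e)           ∎
    where
    open ≤-Reasoning
    ∣C∣≡1+ρ[C-e] : ∣ C ∣ ≡ suc (ρ (C - e))
    ∣C∣≡1+ρ[C-e] = trans (x∈p⇒∣p∣≡1+∣p-x∣ C e∈C) (cong suc (sym (proj₂ (circuit-del-indep C-circuit e∈C))))
    ρC<1+ρ[C-e] : ρ C < suc (ρ (C - e))
    ρC<1+ρ[C-e] = subst (ρ C <_) ∣C∣≡1+ρ[C-e] (≤∧≢⇒< (ρ-bound C⊆E) (λ ρC≡∣C∣ → C-dep (C⊆E , ρC≡∣C∣)))

  circuitThrough⇒ρ-del≡ρ : ∀ {Z e} → Z ⊆ ground → e ∈ Z → CircuitThrough Z e → ρ (Z - e) ≡ ρ Z
  circuitThrough⇒ρ-del≡ρ {Z} {e} Z⊆E e∈Z (C , C-circuit , C⊆Z , e∈C) = begin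
    ρ (Z - e)           ≡⟨ spans-mono (p⊆q⇒p─r⊆q─r ⁅ e ⁆ C⊆Z) (Z⊆E ∘ p─q⊆p Z ⁅ e ⁆) (Z⊆E e∈Z)
                                      (circuit-spans C-circuit e∈C) ⟨
    ρ ((Z - e) ∪ ⁅ e ⁆) ≡⟨ cong ρ (x∈p⇒p-x∪⁅x⁆≡p e∈Z) ⟩
    ρ Z                 ∎
    where open ≡-Reasoning

  ρ-del≡ρ⇒circuitThrough : ∀ {Z e} → Z ⊆ ground → e ∈ Z → ρ (Z - e) ≡ ρ Z → CircuitThrough Z e
  ρ-del≡ρ⇒circuitThrough {Z} {e} Z⊆E e∈Z ρ[Z-e]≡ρZ
    with indep-extends (⊆-min (Z - e)) (Z⊆E ∘ p─q⊆p Z ⁅ e ⁆) indep-⊥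
  ... | J , J-indep , _ , J⊆Z-e , ∣J∣≡ρ[Z-e] with dependent⇒∃circuit⊆ J+e⊆E J+e-dep
    where
    J+e⊆Z : J ∪ ⁅ e ⁆ ⊆ Z
    J+e⊆Z = ∪-lub (p─q⊆p Z ⁅ e ⁆ ∘ J⊆Z-e) (x∈p⇒⁅x⁆⊆p e∈Z)
    J+e⊆E : J ∪ ⁅ e ⁆ ⊆ ground
    J+e⊆E = Z⊆E ∘ J+e⊆Z
    J+e-dep : ¬ Indep R (J ∪ ⁅ e ⁆)
    J+e-dep (_ , ρ≡∣∣) = <-irrefl refl (begin-strict
      ∣ J ∣            <⟨ n<1+n _ ⟩
      suc ∣ J ∣        ≡⟨ x∉p⇒∣p∪⁅x⁆∣≡1+∣p∣ (x∉p-x ∘ J⊆Z-e) ⟨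
      ∣ J ∪ ⁅ e ⁆ ∣    ≡⟨ ρ≡∣∣ ⟨
      ρ (J ∪ ⁅ e ⁆)    ≤⟨ ρ-mono J+e⊆Z Z⊆E ⟩
      ρ Z              ≡⟨ trans (sym ρ[Z-e]≡ρZ) (sym ∣J∣≡ρ[Z-e]) ⟩
      ∣ J ∣            ∎)
      where open ≤-Reasoning
  ...   | C , C-circuit , C⊆J+e with e ∈? C
  ...     | yes e∈C = C , C-circuit , ∪-lub (p─q⊆p Z ⁅ e ⁆ ∘ J⊆Z-e) (x∈p⇒⁅x⁆⊆p e∈Z) ∘ C⊆J+e , e∈C
  ...     | no e∉C = contradiction (indep-⊆ (p⊆q∪⁅x⁆∧x∉p⇒p⊆q C⊆J+e e∉C) J-indep) (proj₁ (proj₂ C-circuit))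

  cyclicFlat⇔ : ∀ {Z} → CyclicFlat R Z ⇔ (Flat R Z × Cyclic R Z)
  cyclicFlat⇔ = mk⇔
    (λ (Z-flat , circuits) → Z-flat , λ e e∈Z → circuitThrough⇒ρ-del≡ρ (proj₁ Z-flat) e∈Z (circuits e e∈Z))
    (λ (Z-flat , Z-cyclic) → Z-flat , λ e e∈Z → ρ-del≡ρ⇒circuitThrough (proj₁ Z-flat) e∈Z (Z-cyclic e e∈Z))

restriction : ∀ (M : Matroid n) {Y} → Y ⊆ E (rk M) → Matroid n
restriction M {Y} Y⊆E = record
  { rk = restrict (rk M) Y
  ; r-bound = λ X X⊆Y → r-bound M X (Y⊆E ∘ X⊆Y)
  ; r-mono = λ X Z X⊆Z Z⊆Y → r-mono M X Z X⊆Z (Y⊆E ∘ Z⊆Y)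
  ; r-sub = λ X Z X⊆Y Z⊆Y → r-sub M X Z (Y⊆E ∘ X⊆Y) (Y⊆E ∘ Z⊆Y)
  }

noIsthmus⇔ : ∀ (M : Matroid n) {Y} → Y ⊆ E (rk M) →
             NoIsthmus (rk M) Y ⇔ Cyclic (rk M) Y
noIsthmus⇔ M {Y} Y⊆E = mk⇔ to from
  where
  open MatroidProperties (restriction M Y⊆E)
  to : NoIsthmus (rk M) Y → Cyclic (rk M) Y
  to no-isthmus e e∈Y with ρ (Y - e) ≟ ρ Y
  ... | yes ρ[Y-e]≡ρY = ρ[Y-e]≡ρY
  ... | no ρ[Y-e]≢ρY = contradiction (e∈Y , e∈every-basis) (no-isthmus e)
    where
    e∈every-basis : ∀ X → Basis (restrict (rk M) Y) X → e ∈ X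
    e∈every-basis X X-basis with e ∈? X | Equivalence.to basis⇔ X-basis
    ... | yes e∈X | _ = e∈X
    ... | no e∉X | (X⊆Y , ρX≡∣X∣) , ∣X∣≡ρY = contradiction (begin-strict
      ρ Y     ≡⟨ trans (sym ∣X∣≡ρY) (sym ρX≡∣X∣) ⟩
      ρ X     ≤⟨ ρ-mono (p⊆q∧x∉p⇒p⊆q-x X⊆Y e∉X) (p─q⊆p Y ⁅ e ⁆) ⟩
      ρ (Y - e) <⟨ ≤∧≢⇒< (ρ-mono (p─q⊆p Y ⁅ e ⁆) ⊆-refl) ρ[Y-e]≢ρY ⟩
      ρ Y     ∎) (<-irrefl refl)
      where open ≤-Reasoning
  from : Cyclic (rk M) Y → NoIsthmus (rk M) Y
  from ρ-del≡ρ e (e∈Y , e∈every-basis) with indep-extends (⊆-min (Y - e)) (p─q⊆p Y ⁅ e ⁆) indep-⊥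
  ... | J , J-indep , _ , J⊆Y-e , ∣J∣≡ρ[Y-e] =
    x∉p-x (J⊆Y-e (e∈every-basis J (Equivalence.from basis⇔ (J-indep , trans ∣J∣≡ρ[Y-e] (ρ-del≡ρ e e∈Y)))))

module FreeSplice (M N : Matroid n) (matched : Matched M N) where

  A B S EL : Subset n
  A = E (rk M)
  B = E (rk N)
  S = A ─ B
  EL = A ∪ B

  L : RankFn n
  L = splice M N

  rM rN rL : Subset n → ℕ
  rM = r (rk M)
  rN = r (rk N)
  rL = r L

  s : ℕ
  s = rM S

  module M′ = MatroidProperties M
  module N′ = MatroidProperties N

  f g : Subset n → ℕ
  f X = rM (X ∩ A) + ∣ X ─ A ∣
  g X = s + rN (X ∩ B)

  S⊆A : S ⊆ A
  S⊆A = p─q⊆p A B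

  rL≡f⊓g : ∀ X → rL X ≡ f X ⊓ g X
  rL≡f⊓g X = cong (f X ⊓_) (+-comm (rN (X ∩ B)) s)

  rL≤f : ∀ X → rL X ≤ f X
  rL≤f X = ≤-trans (≤-reflexive (rL≡f⊓g X)) (m⊓n≤m (f X) (g X))

  rL≤g : ∀ X → rL X ≤ g X
  rL≤g X = ≤-trans (≤-reflexive (rL≡f⊓g X)) (m⊓n≤n (f X) (g X))

  f≤g⇒rL≡f : ∀ {X} → f X ≤ g X → rL X ≡ f X
  f≤g⇒rL≡f {X} f≤g = trans (rL≡f⊓g X) (m≤n⇒m⊓n≡m f≤g)

  g≤f⇒rL≡g : ∀ {X} → g X ≤ f X → rL X ≡ g X
  g≤f⇒rL≡g {X} g≤f = trans (rL≡f⊓g X) (m≥n⇒m⊓n≡n g≤f)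

  rL<g⇒rL≡f : ∀ {X} → rL X < g X → rL X ≡ f X
  rL<g⇒rL≡f {X} rL<g with f X ≤? g X
  ... | yes f≤g = f≤g⇒rL≡f f≤g
  ... | no f≰g = contradiction (subst (_< g X) (g≤f⇒rL≡g (<⇒≤ (≰⇒> f≰g))) rL<g) (<-irrefl refl)

  -- Matching gives the truncated difference r_M(Y ∪ (A − A ∩ B)) ∸ r_M(A − A ∩ B); monotonicity makes it exact.
  rM-∪S : ∀ {Y} → Y ⊆ A ∩ B → rM (Y ∪ S) ≡ rN Y + s
  rM-∪S {Y} Y⊆A∩B = begin
    rM (Y ∪ S)                                ≡⟨ m∸n+n≡m (M′.ρ-mono (q⊆p∪q Y S) (∪-lub (p∩q⊆p A B ∘ Y⊆A∩B) S⊆A)) ⟨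
    rM (Y ∪ S) ∸ s + s                        ≡⟨ cong (λ T → rM (Y ∪ T) ∸ rM T + s) A─[A∩B]≡S ⟨
    rM (Y ∪ (A ─ A ∩ B)) ∸ rM (A ─ A ∩ B) + s ≡⟨ cong (_+ s) (proj₂ matched Y Y⊆A∩B) ⟩
    rN Y + s                                  ∎
    where
    open ≡-Reasoning
    A─[A∩B]≡S : A ─ A ∩ B ≡ S
    A─[A∩B]≡S = set-≡ (v₀ ─ᵉ v₀ ∩ᵉ v₁) (v₀ ─ᵉ v₁) refl (A ∷ B ∷ [])

  spans-M-∪S⇒spans-N : ∀ {Y i} → Y ⊆ A ∩ B → i ∈ A ∩ B → Spans (rk M) (Y ∪ S) i → Spans (rk N) Y i
  spans-M-∪S⇒spans-N {Y} {i} Y⊆A∩B i∈A∩B M-spans = +-cancelʳ-≡ s _ _ (begin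
    rN (Y ∪ ⁅ i ⁆) + s      ≡⟨ rM-∪S (∪-lub Y⊆A∩B (x∈p⇒⁅x⁆⊆p i∈A∩B)) ⟨
    rM ((Y ∪ ⁅ i ⁆) ∪ S)    ≡⟨ cong rM ([p∪q]∪u≡[p∪u]∪q Y ⁅ i ⁆ S) ⟩
    rM ((Y ∪ S) ∪ ⁅ i ⁆)    ≡⟨ M-spans ⟩
    rM (Y ∪ S)              ≡⟨ rM-∪S Y⊆A∩B ⟩
    rN Y + s                ∎)
    where open ≡-Reasoning

  X∩A⊆X∩A∩B∪S : ∀ X → X ∩ A ⊆ X ∩ A ∩ B ∪ S
  X∩A⊆X∩A∩B∪S X = set-⊆ (v₀ ∩ᵉ v₁) (v₀ ∩ᵉ v₁ ∩ᵉ v₂ ∪ᵉ (v₁ ─ᵉ v₂)) refl (X ∷ A ∷ B ∷ [])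

  rM≤g : ∀ {Y} → Y ⊆ A → rM Y ≤ g Y
  rM≤g {Y} Y⊆A = begin
    rM Y              ≤⟨ M′.ρ-mono Y⊆[Y∩B]∪S (∪-lub (Y⊆A ∘ p∩q⊆p Y B) S⊆A) ⟩
    rM (Y ∩ B ∪ S)    ≡⟨ rM-∪S (p⊆q⇒p∩r⊆q∩r B Y⊆A) ⟩
    rN (Y ∩ B) + s    ≡⟨ +-comm (rN (Y ∩ B)) s ⟩
    g Y               ∎
    where
    open ≤-Reasoning
    Y⊆[Y∩B]∪S : Y ⊆ Y ∩ B ∪ S
    Y⊆[Y∩B]∪S = set-⊆ (v₀ ∩ᵉ v₁) (v₀ ∩ᵉ v₂ ∪ᵉ (v₁ ─ᵉ v₂)) refl (Y ∷ A ∷ B ∷ []) ∘ ∩-glb ⊆-refl Y⊆A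

  f-on-A : ∀ {Y} → Y ⊆ A → f Y ≡ rM Y
  f-on-A Y⊆A = trans (cong₂ _+_ (cong rM (p⊆q⇒p∩q≡p Y⊆A)) (p⊆q⇒∣p─q∣≡0 Y⊆A)) (+-identityʳ _)

  rL-on-A : ∀ {Y} → Y ⊆ A → rL Y ≡ rM Y
  rL-on-A Y⊆A = trans (f≤g⇒rL≡f (subst (_≤ g _) (sym (f-on-A Y⊆A)) (rM≤g Y⊆A))) (f-on-A Y⊆A)

  f-bound : ∀ X → f X ≤ ∣ X ∣
  f-bound X = ≤-trans (+-monoˡ-≤ _ (M′.ρ-bound (p∩q⊆q X A))) (≤-reflexive (sym (∣p∣≡∣p∩q∣+∣p─q∣ X A)))

  f-mono : ∀ {X Y} → X ⊆ Y → f X ≤ f Y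
  f-mono X⊆Y = +-mono-≤ (M′.ρ∩-mono X⊆Y) (p⊆q⇒∣p∣≤∣q∣ (p⊆q⇒p─r⊆q─r A X⊆Y))

  g-mono : ∀ {X Y} → X ⊆ Y → g X ≤ g Y
  g-mono X⊆Y = +-monoʳ-≤ s (N′.ρ∩-mono X⊆Y)

  f-submodular : ∀ X Y → f (X ∪ Y) + f (X ∩ Y) ≤ f X + f Y
  f-submodular X Y = begin
    f (X ∪ Y) + f (X ∩ Y)
      ≡⟨ interchange (rM ((X ∪ Y) ∩ A)) _ (rM ((X ∩ Y) ∩ A)) _ ⟩
    (rM ((X ∪ Y) ∩ A) + rM ((X ∩ Y) ∩ A)) + (∣ (X ∪ Y) ─ A ∣ + ∣ (X ∩ Y) ─ A ∣)
      ≤⟨ +-mono-≤ (M′.ρ∩-submodular X Y) (≤-reflexive (∣[p∪q]─r∣+∣[p∩q]─r∣≡∣p─r∣+∣q─r∣ X Y A)) ⟩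
    (rM (X ∩ A) + rM (Y ∩ A)) + (∣ X ─ A ∣ + ∣ Y ─ A ∣)
      ≡⟨ interchange (rM (X ∩ A)) _ (∣ X ─ A ∣) _ ⟩
    f X + f Y ∎
    where open ≤-Reasoning

  g-submodular : ∀ X Y → g (X ∪ Y) + g (X ∩ Y) ≤ g X + g Y
  g-submodular X Y = begin
    g (X ∪ Y) + g (X ∩ Y)                           ≡⟨ interchange s _ s _ ⟩
    (s + s) + (rN ((X ∪ Y) ∩ B) + rN ((X ∩ Y) ∩ B)) ≤⟨ +-monoʳ-≤ (s + s) (N′.ρ∩-submodular X Y) ⟩
    (s + s) + (rN (X ∩ B) + rN (Y ∩ B))             ≡⟨ interchange s s _ _ ⟩
    g X + g Y                                       ∎
    where open ≤-Reasoning

  -- Diminishing returns in N along P ∩ A ⊆ P, carried into M by adjoining S, then diminishing returns in M.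
  exchange : ∀ {P Q U W} → P ⊆ B → Q ⊆ A ∩ B → U ⊆ P ∩ A ∪ S → U ∪ Q ⊆ W → W ⊆ A →
             rN (P ∪ Q) + rM U ≤ rN P + rM W
  exchange {P} {Q} {U} {W} P⊆B Q⊆A∩B U⊆PA∪S U∪Q⊆W W⊆A = +-cancelʳ-≤ (rN PA + s) _ _ (begin
    (rN (P ∪ Q) + rM U) + (rN PA + s)   ≡⟨ shuffle₁ (rN (P ∪ Q)) (rM U) (rN PA) s ⟩
    (rN (P ∪ Q) + rN PA) + (s + rM U)   ≤⟨ +-monoˡ-≤ (s + rM U)
                                             (N′.ρ-diminishing-returns (p∩q⊆p P A) P⊆B (p∩q⊆q A B ∘ Q⊆A∩B)) ⟩
    (rN P + rN (PA ∪ Q)) + (s + rM U)   ≡⟨ shuffle₂ (rN P) (rN (PA ∪ Q)) s (rM U) ⟩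
    rN P + ((rN (PA ∪ Q) + s) + rM U)   ≡⟨ cong (λ k → rN P + (k + rM U)) (rM-∪S (∪-lub PA⊆A∩B Q⊆A∩B)) ⟨
    rN P + (rM ((PA ∪ Q) ∪ S) + rM U)   ≡⟨ cong (λ T → rN P + (rM T + rM U)) ([p∪q]∪u≡[p∪u]∪q PA Q S) ⟩
    rN P + (rM ((PA ∪ S) ∪ Q) + rM U)   ≤⟨ +-monoʳ-≤ (rN P)
                                             (M′.ρ-diminishing-returns U⊆PA∪S PA∪S⊆A (p∩q⊆p A B ∘ Q⊆A∩B)) ⟩
    rN P + (rM (PA ∪ S) + rM (U ∪ Q))   ≤⟨ +-monoʳ-≤ (rN P) (+-monoʳ-≤ (rM (PA ∪ S)) (M′.ρ-mono U∪Q⊆W W⊆A)) ⟩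
    rN P + (rM (PA ∪ S) + rM W)         ≡⟨ cong (λ k → rN P + (k + rM W)) (rM-∪S PA⊆A∩B) ⟩
    rN P + ((rN PA + s) + rM W)         ≡⟨ shuffle₃ (rN P) (rN PA + s) (rM W) ⟩
    (rN P + rM W) + (rN PA + s)         ∎)
    where
    open ≤-Reasoning
    PA : Subset n
    PA = P ∩ A
    PA⊆A∩B : PA ⊆ A ∩ B
    PA⊆A∩B = ∩-glb (p∩q⊆q P A) (P⊆B ∘ p∩q⊆p P A)
    PA∪S⊆A : PA ∪ S ⊆ A
    PA∪S⊆A = ∪-lub (p∩q⊆q P A) S⊆A
    shuffle₁ : ∀ a u p t → (a + u) + (p + t) ≡ (a + p) + (t + u)
    shuffle₁ = solve-∀
    shuffle₂ : ∀ b c t u → (b + c) + (t + u) ≡ b + ((c + t) + u)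
    shuffle₂ = solve-∀
    shuffle₃ : ∀ b k x → b + (k + x) ≡ (b + x) + k
    shuffle₃ = solve-∀

  rN[[X∪Y]∩B]≤ : ∀ X Y → rN ((X ∪ Y) ∩ B) ≤ rN (Y ∩ B ∪ (X ─ Y) ∩ (A ∩ B)) + ∣ (X ─ Y) ─ A ∣
  rN[[X∪Y]∩B]≤ X Y = begin
    rN ((X ∪ Y) ∩ B)    ≤⟨ N′.ρ-mono (set-⊆ ((v₀ ∪ᵉ v₁) ∩ᵉ v₃)
                                            ((v₁ ∩ᵉ v₃ ∪ᵉ (v₀ ─ᵉ v₁) ∩ᵉ (v₂ ∩ᵉ v₃)) ∪ᵉ ((v₀ ─ᵉ v₁) ─ᵉ v₂) ∩ᵉ v₃)
                                            refl (X ∷ Y ∷ A ∷ B ∷ []))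
                                     (∪-lub P∪Q⊆B (p∩q⊆q ((X ─ Y) ─ A) B)) ⟩
    rN ((P ∪ Q) ∪ R)    ≤⟨ N′.ρ-∪≤ρ+∣∣ P∪Q⊆B (p∩q⊆q ((X ─ Y) ─ A) B) ⟩
    rN (P ∪ Q) + ∣ R ∣  ≤⟨ +-monoʳ-≤ (rN (P ∪ Q)) (p⊆q⇒∣p∣≤∣q∣ (p∩q⊆p ((X ─ Y) ─ A) B)) ⟩
    rN (P ∪ Q) + ∣ (X ─ Y) ─ A ∣ ∎
    where
    open ≤-Reasoning
    P Q R : Subset n
    P = Y ∩ B
    Q = (X ─ Y) ∩ (A ∩ B)
    R = ((X ─ Y) ─ A) ∩ B
    P∪Q⊆B : P ∪ Q ⊆ B
    P∪Q⊆B = ∪-lub (p∩q⊆q Y B) (p∩q⊆q A B ∘ p∩q⊆q (X ─ Y) (A ∩ B))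

  fg-mixed-submodular : ∀ X Y → g (X ∪ Y) + f (X ∩ Y) ≤ f X + g Y
  fg-mixed-submodular X Y = begin
    (s + rN ((X ∪ Y) ∩ B)) + (rM U + ∣ (X ∩ Y) ─ A ∣)
      ≤⟨ +-monoˡ-≤ (rM U + ∣ (X ∩ Y) ─ A ∣) (+-monoʳ-≤ s (rN[[X∪Y]∩B]≤ X Y)) ⟩
    (s + (rN (P ∪ Q) + ∣ (X ─ Y) ─ A ∣)) + (rM U + ∣ (X ∩ Y) ─ A ∣)
      ≡⟨ shuffle₁ s (rN (P ∪ Q)) (∣ (X ─ Y) ─ A ∣) (rM U) (∣ (X ∩ Y) ─ A ∣) ⟩
    (rN (P ∪ Q) + rM U) + (s + (∣ (X ∩ Y) ─ A ∣ + ∣ (X ─ Y) ─ A ∣))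
      ≤⟨ +-monoˡ-≤ (s + (∣ (X ∩ Y) ─ A ∣ + ∣ (X ─ Y) ─ A ∣))
                   (exchange (p∩q⊆q Y B) (p∩q⊆q (X ─ Y) (A ∩ B)) (set-⊆ eU (eP ∩ᵉ v₂ ∪ᵉ (v₂ ─ᵉ v₃)) refl env)
                             (set-⊆ (eU ∪ᵉ eQ) (v₀ ∩ᵉ v₂) refl env) (p∩q⊆q X A)) ⟩
    (rN P + rM (X ∩ A)) + (s + (∣ (X ∩ Y) ─ A ∣ + ∣ (X ─ Y) ─ A ∣))
      ≡⟨ cong (λ k → (rN P + rM (X ∩ A)) + (s + k)) (∣p─r∣≡∣[p∩q]─r∣+∣[p─q]─r∣ X Y A) ⟨
    (rN P + rM (X ∩ A)) + (s + ∣ X ─ A ∣)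
      ≡⟨ shuffle₂ (rN P) (rM (X ∩ A)) s (∣ X ─ A ∣) ⟩
    (rM (X ∩ A) + ∣ X ─ A ∣) + (s + rN P) ∎
    where
    open ≤-Reasoning
    env : Vec (Subset n) 4
    env = X ∷ Y ∷ A ∷ B ∷ []
    eP eQ eU : SetExpr 4
    eP = v₁ ∩ᵉ v₃
    eQ = (v₀ ─ᵉ v₁) ∩ᵉ (v₂ ∩ᵉ v₃)
    eU = (v₀ ∩ᵉ v₁) ∩ᵉ v₂
    P Q U : Subset n
    P = ⟦ eP ⟧ env
    Q = ⟦ eQ ⟧ env
    U = ⟦ eU ⟧ env
    shuffle₁ : ∀ t a d u c → (t + (a + d)) + (u + c) ≡ (a + u) + (t + (c + d))
    shuffle₁ = solve-∀
    shuffle₂ : ∀ b x t c → (b + x) + (t + c) ≡ (x + c) + (t + b)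
    shuffle₂ = solve-∀

  rL-submodular : ∀ X Y → rL (X ∪ Y) + rL (X ∩ Y) ≤ rL X + rL Y
  rL-submodular X Y with f X ≤? g X | f Y ≤? g Y
  ... | yes fX≤gX | yes fY≤gY = begin
    rL (X ∪ Y) + rL (X ∩ Y) ≤⟨ +-mono-≤ (rL≤f (X ∪ Y)) (rL≤f (X ∩ Y)) ⟩
    f (X ∪ Y) + f (X ∩ Y)   ≤⟨ f-submodular X Y ⟩
    f X + f Y               ≡⟨ cong₂ _+_ (f≤g⇒rL≡f fX≤gX) (f≤g⇒rL≡f fY≤gY) ⟨
    rL X + rL Y             ∎
    where open ≤-Reasoning
  ... | no fX≰gX | no fY≰gY = begin
    rL (X ∪ Y) + rL (X ∩ Y) ≤⟨ +-mono-≤ (rL≤g (X ∪ Y)) (rL≤g (X ∩ Y)) ⟩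
    g (X ∪ Y) + g (X ∩ Y)   ≤⟨ g-submodular X Y ⟩
    g X + g Y               ≡⟨ cong₂ _+_ (g≤f⇒rL≡g (<⇒≤ (≰⇒> fX≰gX))) (g≤f⇒rL≡g (<⇒≤ (≰⇒> fY≰gY))) ⟨
    rL X + rL Y             ∎
    where open ≤-Reasoning
  ... | yes fX≤gX | no fY≰gY = begin
    rL (X ∪ Y) + rL (X ∩ Y) ≤⟨ +-mono-≤ (rL≤g (X ∪ Y)) (rL≤f (X ∩ Y)) ⟩
    g (X ∪ Y) + f (X ∩ Y)   ≤⟨ fg-mixed-submodular X Y ⟩
    f X + g Y               ≡⟨ cong₂ _+_ (f≤g⇒rL≡f fX≤gX) (g≤f⇒rL≡g (<⇒≤ (≰⇒> fY≰gY))) ⟨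
    rL X + rL Y             ∎
    where open ≤-Reasoning
  ... | no fX≰gX | yes fY≤gY = begin
    rL (X ∪ Y) + rL (X ∩ Y) ≤⟨ +-mono-≤ (rL≤g (X ∪ Y)) (rL≤f (X ∩ Y)) ⟩
    g (X ∪ Y) + f (X ∩ Y)   ≡⟨ cong₂ (λ U V → g U + f V) (∪-comm X Y) (∩-comm X Y) ⟩
    g (Y ∪ X) + f (Y ∩ X)   ≤⟨ fg-mixed-submodular Y X ⟩
    f Y + g X               ≡⟨ +-comm (f Y) (g X) ⟩
    g X + f Y               ≡⟨ cong₂ _+_ (g≤f⇒rL≡g (<⇒≤ (≰⇒> fX≰gX))) (f≤g⇒rL≡f fY≤gY) ⟨
    rL X + rL Y             ∎
    where open ≤-Reasoning

  spliceMatroid : Matroid n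
  spliceMatroid = record
    { rk = L
    ; r-bound = λ X _ → ≤-trans (rL≤f X) (f-bound X)
    ; r-mono = λ X Y X⊆Y _ → subst₂ _≤_ (sym (rL≡f⊓g X)) (sym (rL≡f⊓g Y)) (⊓-mono-≤ (f-mono X⊆Y) (g-mono X⊆Y))
    ; r-sub = λ X Y _ _ → rL-submodular X Y
    }

  module L′ = MatroidProperties spliceMatroid

  S⊆X⇒f≡ : ∀ {X} → S ⊆ X → f X ≡ s + (rN (X ∩ A ∩ B) + ∣ X ─ A ∣)
  S⊆X⇒f≡ {X} S⊆X = begin
    rM (X ∩ A) + ∣ X ─ A ∣                 ≡⟨ cong (λ U → rM U + ∣ X ─ A ∣) X∩A≡X∩A∩B∪S ⟩
    rM (X ∩ A ∩ B ∪ S) + ∣ X ─ A ∣         ≡⟨ cong (_+ ∣ X ─ A ∣) (rM-∪S (p∩q⊆q X (A ∩ B))) ⟩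
    (rN (X ∩ A ∩ B) + s) + ∣ X ─ A ∣       ≡⟨ xy∙z≈y∙xz (rN (X ∩ A ∩ B)) s (∣ X ─ A ∣) ⟩
    s + (rN (X ∩ A ∩ B) + ∣ X ─ A ∣)       ∎
    where
    open ≡-Reasoning
    X∩A≡X∩A∩B∪S : X ∩ A ≡ X ∩ A ∩ B ∪ S
    X∩A≡X∩A∩B∪S = ⊆-antisym (X∩A⊆X∩A∩B∪S X)
                            (∪-lub (∩-glb (p∩q⊆p X (A ∩ B)) (p∩q⊆p A B ∘ p∩q⊆q X (A ∩ B))) (∩-glb S⊆X S⊆A))

  rN[X∩B]≤ : ∀ {X} → X ⊆ EL → rN (X ∩ B) ≤ rN (X ∩ A ∩ B) + ∣ X ─ A ∣
  rN[X∩B]≤ {X} X⊆EL =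
    ≤-trans (N′.ρ-mono (set-⊆ (v₀ ∩ᵉ v₂) (v₀ ∩ᵉ v₁ ∩ᵉ v₂ ∪ᵉ (v₀ ─ᵉ v₁)) refl (X ∷ A ∷ B ∷ [])) (∪-lub T⊆B X─A⊆B))
            (N′.ρ-∪≤ρ+∣∣ T⊆B X─A⊆B)
    where
    T⊆B : X ∩ A ∩ B ⊆ B
    T⊆B = p∩q⊆q A B ∘ p∩q⊆q X (A ∩ B)
    X─A⊆B : X ─ A ⊆ B
    X─A⊆B = p⊆q∪r⇒p─q⊆r A B X⊆EL

  S⊆X⇒g≤f : ∀ {X} → X ⊆ EL → S ⊆ X → g X ≤ f X
  S⊆X⇒g≤f X⊆EL S⊆X = ≤-trans (+-monoʳ-≤ s (rN[X∩B]≤ X⊆EL)) (≤-reflexive (sym (S⊆X⇒f≡ S⊆X)))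

  S⊆X⇒rL≡g : ∀ {X} → X ⊆ EL → S ⊆ X → rL X ≡ g X
  S⊆X⇒rL≡g X⊆EL S⊆X = g≤f⇒rL≡g (S⊆X⇒g≤f X⊆EL S⊆X)

  splice-rank : rank L ≡ s + rank (rk N)
  splice-rank = trans (S⊆X⇒rL≡g ⊆-refl (p⊆p∪q B ∘ S⊆A))
                      (cong (λ U → s + rN U) (set-≡ ((v₀ ∪ᵉ v₁) ∩ᵉ v₁) v₁ refl (A ∷ B ∷ [])))

  splice-indep⇔ : ∀ X → Indep L X ⇔ (X ⊆ EL × Indep (rk M) (X ∩ A) × ∣ X ∣ ≤ g X)
  splice-indep⇔ X = mk⇔ to from
    where
    f≡∣X∣⇔ : f X ≡ ∣ X ∣ ⇔ rM (X ∩ A) ≡ ∣ X ∩ A ∣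
    f≡∣X∣⇔ = mk⇔ (λ f≡∣X∣ → +-cancelʳ-≡ ∣ X ─ A ∣ _ _ (trans f≡∣X∣ (∣p∣≡∣p∩q∣+∣p─q∣ X A)))
                 (λ rM≡∣∣ → trans (cong (_+ ∣ X ─ A ∣) rM≡∣∣) (sym (∣p∣≡∣p∩q∣+∣p─q∣ X A)))
    to : Indep L X → X ⊆ EL × Indep (rk M) (X ∩ A) × ∣ X ∣ ≤ g X
    to (X⊆EL , rL≡∣X∣) =
      X⊆EL , (p∩q⊆q X A , Equivalence.to f≡∣X∣⇔ (≤-antisym (f-bound X) (subst (_≤ f X) rL≡∣X∣ (rL≤f X)))) ,
      subst (_≤ g X) rL≡∣X∣ (rL≤g X)
    from : X ⊆ EL × Indep (rk M) (X ∩ A) × ∣ X ∣ ≤ g X → Indep L X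
    from (X⊆EL , (_ , rM≡∣∣) , ∣X∣≤g) = X⊆EL , trans (f≤g⇒rL≡f (subst (_≤ g X) (sym f≡∣X∣) ∣X∣≤g)) f≡∣X∣
      where
      f≡∣X∣ : f X ≡ ∣ X ∣
      f≡∣X∣ = Equivalence.from f≡∣X∣⇔ rM≡∣∣

  splice-spanning⇔ : ∀ X → Spanning L X ⇔ (X ⊆ EL × Spanning (rk N) (X ∩ B) × f X ≥ s + rank (rk N))
  splice-spanning⇔ X = mk⇔ to from
    where
    to : Spanning L X → X ⊆ EL × Spanning (rk N) (X ∩ B) × f X ≥ s + rank (rk N)
    to (X⊆EL , rL≡rank) =
      X⊆EL ,
      (p∩q⊆q X B , ≤-antisym (N′.ρ-mono (p∩q⊆q X B) ⊆-refl)
                             (+-cancelˡ-≤ s _ _ (subst (_≤ g X) (trans rL≡rank splice-rank) (rL≤g X)))) ,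
      subst (_≤ f X) (trans rL≡rank splice-rank) (rL≤f X)
    from : X ⊆ EL × Spanning (rk N) (X ∩ B) × f X ≥ s + rank (rk N) → Spanning L X
    from (X⊆EL , (_ , rN≡rank) , rank≤f) =
      X⊆EL , trans (g≤f⇒rL≡g (subst (_≤ f X) (sym g≡rank) rank≤f)) (trans g≡rank (sym splice-rank))
      where
      g≡rank : g X ≡ s + rank (rk N)
      g≡rank = cong (s +_) rN≡rank

  splice-basis⇔ : ∀ X → Basis L X ⇔
                  (X ⊆ EL × ∣ X ∣ ≡ s + rank (rk N) × Indep (rk M) (X ∩ A) × Spanning (rk N) (X ∩ B))
  splice-basis⇔ X = mk⇔ to from
    where
    to : Basis L X → X ⊆ EL × ∣ X ∣ ≡ s + rank (rk N) × Indep (rk M) (X ∩ A) × Spanning (rk N) (X ∩ B)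
    to X-basis with Equivalence.to L′.basis⇔ X-basis
    ... | X-indep , ∣X∣≡rank with Equivalence.to (splice-indep⇔ X) X-indep
    ...   | X⊆EL , X∩A-indep , ∣X∣≤g =
      X⊆EL , ∣X∣≡rr , X∩A-indep ,
      (p∩q⊆q X B , ≤-antisym (N′.ρ-mono (p∩q⊆q X B) ⊆-refl) (+-cancelˡ-≤ s _ _ (subst (_≤ g X) ∣X∣≡rr ∣X∣≤g)))
      where
      ∣X∣≡rr : ∣ X ∣ ≡ s + rank (rk N)
      ∣X∣≡rr = trans ∣X∣≡rank splice-rank
    from : X ⊆ EL × ∣ X ∣ ≡ s + rank (rk N) × Indep (rk M) (X ∩ A) × Spanning (rk N) (X ∩ B) → Basis L X
    from (X⊆EL , ∣X∣≡rr , X∩A-indep , (_ , rN≡rank)) = Equivalence.from L′.basis⇔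
      ( Equivalence.from (splice-indep⇔ X) (X⊆EL , X∩A-indep , ≤-reflexive (trans ∣X∣≡rr (cong (s +_) (sym rN≡rank))))
      , trans ∣X∣≡rr (sym splice-rank))

  indep-on-A⇔ : ∀ {Y} → Y ⊆ A → Indep L Y ⇔ Indep (rk M) Y
  indep-on-A⇔ Y⊆A = mk⇔ (λ (_ , rL≡∣Y∣) → Y⊆A , trans (sym (rL-on-A Y⊆A)) rL≡∣Y∣)
                        (λ (_ , rM≡∣Y∣) → p⊆p∪q B ∘ Y⊆A , trans (rL-on-A Y⊆A) rM≡∣Y∣)

  circuit-M⇒circuit-L : ∀ {X} → Circuit (rk M) X → Circuit L X
  circuit-M⇒circuit-L (X⊆A , X-dep , proper-indep) =
    p⊆p∪q B ∘ X⊆A ,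
    X-dep ∘ Equivalence.to (indep-on-A⇔ X⊆A) ,
    λ Y Y⊆X Y≢X → Equivalence.from (indep-on-A⇔ (X⊆A ∘ Y⊆X)) (proper-indep Y Y⊆X Y≢X)

  circuit-L⇒circuit-M : ∀ {X} → Circuit L X → ¬ Indep (rk M) (X ∩ A) → Circuit (rk M) X
  circuit-L⇒circuit-M {X} (_ , X-dep , proper-indep) X∩A-dep =
    X⊆A ,
    X-dep ∘ Equivalence.from (indep-on-A⇔ X⊆A) ,
    λ Y Y⊆X Y≢X → Equivalence.to (indep-on-A⇔ (X⊆A ∘ Y⊆X)) (proper-indep Y Y⊆X Y≢X)
    where
    X⊆A : X ⊆ A
    X⊆A with X ⊆? A
    ... | yes X⊆A = X⊆A
    ... | no X⊈A = contradiction
      (Equivalence.to (indep-on-A⇔ (p∩q⊆q X A))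
        (proper-indep (X ∩ A) (p∩q⊆p X A) (λ X∩A≡X → X⊈A (subst (_⊆ A) X∩A≡X (p∩q⊆q X A)))))
      X∩A-dep

  SpliceCircuit : Subset n → Set
  SpliceCircuit X = X ⊆ EL × Indep (rk M) (X ∩ A) × NoIsthmus (rk N) (X ∩ B) × rN (X ∩ B) + s + 1 ≡ ∣ X ∣

  [X-e]∩B≡[X∩B]-e : ∀ X e → (X - e) ∩ B ≡ (X ∩ B) - e
  [X-e]∩B≡[X∩B]-e X e = set-≡ ((v₀ ─ᵉ v₂) ∩ᵉ v₁) ((v₀ ∩ᵉ v₁) ─ᵉ v₂) refl (X ∷ B ∷ ⁅ e ⁆ ∷ [])

  ∣X∣≡1+g⇔ : ∀ {X} → ∣ X ∣ ≡ suc (g X) ⇔ rN (X ∩ B) + s + 1 ≡ ∣ X ∣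
  ∣X∣≡1+g⇔ {X} = mk⇔ (λ ∣X∣≡ → trans (reorder (rN (X ∩ B)) s) (sym ∣X∣≡))
                     (λ ≡∣X∣ → sym (trans (sym (reorder (rN (X ∩ B)) s)) ≡∣X∣))
    where
    reorder : ∀ a t → a + t + 1 ≡ suc (t + a)
    reorder = solve-∀

  circuit-L⇒spliceCircuit : ∀ {X} → Circuit L X → Indep (rk M) (X ∩ A) → SpliceCircuit X
  circuit-L⇒spliceCircuit {X} X-circuit@(X⊆EL , X-dep , _) X∩A-indep =
    X⊆EL , X∩A-indep ,
    Equivalence.from (noIsthmus⇔ N (p∩q⊆q X B)) (λ e e∈X∩B → ≤-antisym
      (N′.ρ-mono (p─q⊆p (X ∩ B) ⁅ e ⁆) (p∩q⊆q X B))
      (+-cancelˡ-≤ s _ _ (begin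
        g X          ≡⟨ suc-injective (trans (sym ∣X∣≡1+g) (x∈p⇒∣p∣≡1+∣p-x∣ X (p∩q⊆p X B e∈X∩B))) ⟩
        ∣ X - e ∣    ≤⟨ ∣X-e∣≤g[X-e] (p∩q⊆p X B e∈X∩B) ⟩
        g (X - e)    ≡⟨ cong (λ U → s + rN U) ([X-e]∩B≡[X∩B]-e X e) ⟩
        s + rN ((X ∩ B) - e) ∎))) ,
    Equivalence.to ∣X∣≡1+g⇔ ∣X∣≡1+g
    where
    open ≤-Reasoning
    g<∣X∣ : g X < ∣ X ∣
    g<∣X∣ = ≰⇒> λ ∣X∣≤g → X-dep (Equivalence.from (splice-indep⇔ X) (X⊆EL , X∩A-indep , ∣X∣≤g))
    ∣X-e∣≤g[X-e] : ∀ {e} → e ∈ X → ∣ X - e ∣ ≤ g (X - e)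
    ∣X-e∣≤g[X-e] e∈X = proj₂ (proj₂ (Equivalence.to (splice-indep⇔ _) (circuit-del-indep X-circuit e∈X)))
    ∣X∣≡1+g : ∣ X ∣ ≡ suc (g X)
    ∣X∣≡1+g with nonempty? X
    ... | no X-empty = contradiction (subst (g X <_) (trans (cong ∣_∣ (Empty-unique X-empty)) (∣⊥∣≡0 n)) g<∣X∣) (λ ())
    ... | yes (e , e∈X) = ≤-antisym (begin
      ∣ X ∣            ≡⟨ x∈p⇒∣p∣≡1+∣p-x∣ X e∈X ⟩
      suc ∣ X - e ∣    ≤⟨ s≤s (∣X-e∣≤g[X-e] e∈X) ⟩
      suc (g (X - e))  ≤⟨ s≤s (g-mono (p─q⊆p X ⁅ e ⁆)) ⟩
      suc (g X)        ∎) g<∣X∣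

  spliceCircuit⇒circuit-L : ∀ {X} → SpliceCircuit X → Circuit L X
  spliceCircuit⇒circuit-L {X} (X⊆EL , X∩A-indep , no-isthmus , size) = X⊆EL , X-dep , proper-indep
    where
    open ≤-Reasoning
    ∣X∣≡1+g : ∣ X ∣ ≡ suc (g X)
    ∣X∣≡1+g = Equivalence.from ∣X∣≡1+g⇔ size
    X-dep : ¬ Indep L X
    X-dep X-indep = <-irrefl refl (subst (_≤ g X) ∣X∣≡1+g (proj₂ (proj₂ (Equivalence.to (splice-indep⇔ X) X-indep))))
    proper-indep : ∀ Y → Y ⊆ X → Y ≢ X → Indep L Y
    proper-indep Y Y⊆X Y≢X =
      Equivalence.from (splice-indep⇔ Y) (X⊆EL ∘ Y⊆X , M′.indep-⊆ (p⊆q⇒p∩r⊆q∩r A Y⊆X) X∩A-indep , ∣Y∣≤g)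
      where
      1+rN≤rN+∣X─Y∣ : suc (rN (X ∩ B)) ≤ rN (Y ∩ B) + ∣ X ─ Y ∣
      1+rN≤rN+∣X─Y∣ with (X ∩ B) ⊆? Y | ⊈⇒∃ (Y≢X ∘ ⊆-antisym Y⊆X)
      ... | yes X∩B⊆Y | e , e∈X , e∉Y = begin
        suc (rN (X ∩ B))          ≡⟨ +-comm 1 (rN (X ∩ B)) ⟩
        rN (X ∩ B) + 1            ≤⟨ +-mono-≤ (N′.ρ-mono (∩-glb X∩B⊆Y (p∩q⊆q X B)) (p∩q⊆q Y B))
                                         (subst (1 ≤_) (sym (x∈p⇒∣p∣≡1+∣p-x∣ (X ─ Y) (x∈p∧x∉q⇒x∈p─q e∈X e∉Y)))
                                                (s≤s z≤n)) ⟩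
        rN (Y ∩ B) + ∣ X ─ Y ∣    ∎
      ... | no X∩B⊈Y | _ with ⊈⇒∃ X∩B⊈Y
      ...   | e , e∈X∩B , e∉Y = begin
        suc (rN (X ∩ B))                  ≤⟨ N′.ρ-del≡ρ⇒ρ<ρ+∣─∣ (p∩q⊆q X B) (p∩q⊆q Y B) e∈X∩B (e∉Y ∘ p∩q⊆p Y B)
                                               (Equivalence.to (noIsthmus⇔ N (p∩q⊆q X B)) no-isthmus e e∈X∩B) ⟩
        rN (Y ∩ B) + ∣ X ∩ B ─ Y ∩ B ∣    ≤⟨ +-monoʳ-≤ (rN (Y ∩ B)) (p⊆q⇒∣p∣≤∣q∣
                                               (set-⊆ (v₀ ∩ᵉ v₂ ─ᵉ v₁ ∩ᵉ v₂) (v₀ ─ᵉ v₁) refl (X ∷ Y ∷ B ∷ []))) ⟩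
        rN (Y ∩ B) + ∣ X ─ Y ∣            ∎
      ∣Y∣≤g : ∣ Y ∣ ≤ g Y
      ∣Y∣≤g = +-cancelʳ-≤ ∣ X ─ Y ∣ _ _ (begin
        ∣ Y ∣ + ∣ X ─ Y ∣              ≡⟨ cong (λ U → ∣ U ∣ + ∣ X ─ Y ∣) (trans (∩-comm X Y) (p⊆q⇒p∩q≡p Y⊆X)) ⟨
        ∣ X ∩ Y ∣ + ∣ X ─ Y ∣          ≡⟨ ∣p∣≡∣p∩q∣+∣p─q∣ X Y ⟨
        ∣ X ∣                          ≡⟨ trans ∣X∣≡1+g (sym (+-suc s (rN (X ∩ B)))) ⟩
        s + suc (rN (X ∩ B))           ≤⟨ +-monoʳ-≤ s 1+rN≤rN+∣X─Y∣ ⟩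
        s + (rN (Y ∩ B) + ∣ X ─ Y ∣)   ≡⟨ +-assoc s (rN (Y ∩ B)) (∣ X ─ Y ∣) ⟨
        g Y + ∣ X ─ Y ∣                ∎)

  splice-circuit⇔ : ∀ X → Circuit L X ⇔ (Circuit (rk M) X ⊎ SpliceCircuit X)
  splice-circuit⇔ X = mk⇔ to [ circuit-M⇒circuit-L , spliceCircuit⇒circuit-L ]′
    where
    to : Circuit L X → Circuit (rk M) X ⊎ SpliceCircuit X
    to X-circuit with M′.indep? (X ∩ A)
    ... | yes X∩A-indep = inj₂ (circuit-L⇒spliceCircuit X-circuit X∩A-indep)
    ... | no X∩A-dep = inj₁ (circuit-L⇒circuit-M X-circuit X∩A-dep)

  f-∪⁅⁆-∈A : ∀ X {i} → i ∈ A → f (X ∪ ⁅ i ⁆) ≡ rM (X ∩ A ∪ ⁅ i ⁆) + ∣ X ─ A ∣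
  f-∪⁅⁆-∈A X i∈A = cong₂ (λ U V → rM U + ∣ V ∣) (x∈q⇒[p∪⁅x⁆]∩q≡p∩q∪⁅x⁆ X A i∈A) (x∈q⇒[p∪⁅x⁆]─q≡p─q X A i∈A)

  f-∪⁅⁆-∉A : ∀ X {i} → i ∉ A → i ∉ X → f (X ∪ ⁅ i ⁆) ≡ suc (f X)
  f-∪⁅⁆-∉A X {i} i∉A i∉X = begin
    f (X ∪ ⁅ i ⁆)                     ≡⟨ cong₂ (λ U V → rM U + ∣ V ∣) (x∉q⇒[p∪⁅x⁆]∩q≡p∩q X A i∉A)
                                                                     (x∉q⇒[p∪⁅x⁆]─q≡[p─q]∪⁅x⁆ X A i∉A) ⟩
    rM (X ∩ A) + ∣ (X ─ A) ∪ ⁅ i ⁆ ∣  ≡⟨ cong (rM (X ∩ A) +_) (x∉p⇒∣p∪⁅x⁆∣≡1+∣p∣ (i∉X ∘ p─q⊆p X A)) ⟩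
    rM (X ∩ A) + suc ∣ X ─ A ∣        ≡⟨ +-suc (rM (X ∩ A)) (∣ X ─ A ∣) ⟩
    suc (f X)                         ∎
    where open ≡-Reasoning

  g-∪⁅⁆-∈B : ∀ X {i} → i ∈ B → g (X ∪ ⁅ i ⁆) ≡ s + rN (X ∩ B ∪ ⁅ i ⁆)
  g-∪⁅⁆-∈B X i∈B = cong (λ U → s + rN U) (x∈q⇒[p∪⁅x⁆]∩q≡p∩q∪⁅x⁆ X B i∈B)

  g-∪⁅⁆-∉B : ∀ X {i} → i ∉ B → g (X ∪ ⁅ i ⁆) ≡ g X
  g-∪⁅⁆-∉B X i∉B = cong (λ U → s + rN U) (x∉q⇒[p∪⁅x⁆]∩q≡p∩q X B i∉B)

  f-∪⁅⁆≡f⇒∈cl-M : ∀ {X i} → i ∉ X → f (X ∪ ⁅ i ⁆) ≡ f X → i ∈ cl (rk M) (X ∩ A)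
  f-∪⁅⁆≡f⇒∈cl-M {X} {i} i∉X f≡f with i ∈? A
  ... | yes i∈A = ∈cl⁺ (rk M) (X ∩ A) i∈A (+-cancelʳ-≡ ∣ X ─ A ∣ _ _ (trans (sym (f-∪⁅⁆-∈A X i∈A)) f≡f))
  ... | no i∉A = contradiction (trans (sym (f-∪⁅⁆-∉A X i∉A i∉X)) f≡f) 1+n≢n

  ∈cl-M⇒f-∪⁅⁆≡f : ∀ {X i} → i ∈ cl (rk M) (X ∩ A) → f (X ∪ ⁅ i ⁆) ≡ f X
  ∈cl-M⇒f-∪⁅⁆≡f {X} i∈cl with ∈cl⁻ (rk M) (X ∩ A) i∈cl
  ... | i∈A , M-spans = trans (f-∪⁅⁆-∈A X i∈A) (cong (_+ ∣ X ─ A ∣) M-spans)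

  ∈cl-M⇒spans-N : ∀ {X i} → i ∈ B → i ∈ cl (rk M) (X ∩ A) → Spans (rk N) (X ∩ B) i
  ∈cl-M⇒spans-N {X} {i} i∈B i∈cl with ∈cl⁻ (rk M) (X ∩ A) i∈cl
  ... | i∈A , X∩A-spans =
    N′.spans-mono (∩-glb (p∩q⊆p X (A ∩ B)) (p∩q⊆q A B ∘ T⊆A∩B)) (p∩q⊆q X B) i∈B
      (spans-M-∪S⇒spans-N T⊆A∩B (x∈p∩q⁺ (i∈A , i∈B))
        (M′.spans-mono (X∩A⊆X∩A∩B∪S X) (∪-lub (p∩q⊆p A B ∘ T⊆A∩B) S⊆A) i∈A X∩A-spans))
    where
    T⊆A∩B : X ∩ A ∩ B ⊆ A ∩ B
    T⊆A∩B = p∩q⊆q X (A ∩ B)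

  rL-∪⁅⁆≤⇒∈cl : ∀ {X i} → X ⊆ EL → i ∈ EL → rL (X ∪ ⁅ i ⁆) ≤ rL X → i ∈ cl L X
  rL-∪⁅⁆≤⇒∈cl {X} X⊆EL i∈EL rL≤rL =
    ∈cl⁺ L X i∈EL (≤-antisym rL≤rL (L′.ρ-mono (p⊆p∪q _) (∪-lub X⊆EL (x∈p⇒⁅x⁆⊆p i∈EL))))

  splice-cl-< : ∀ {X} → X ⊆ EL → f X < g X → cl L X ≡ cl (rk M) (X ∩ A) ∪ X
  splice-cl-< {X} X⊆EL f<g = ⊆-antisym cl⊆ (∪-lub M-cl⊆ (⊆-cl L X⊆EL))
    where
    rL≡f : rL X ≡ f X
    rL≡f = f≤g⇒rL≡f (<⇒≤ f<g)
    f-stable : ∀ {i} → Spans L X i → f (X ∪ ⁅ i ⁆) ≡ f X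
    f-stable {i} L-spans = trans (sym (rL<g⇒rL≡f rL[X+i]<g[X+i])) rL[X+i]≡f
      where
      rL[X+i]≡f : rL (X ∪ ⁅ i ⁆) ≡ f X
      rL[X+i]≡f = trans L-spans rL≡f
      rL[X+i]<g[X+i] : rL (X ∪ ⁅ i ⁆) < g (X ∪ ⁅ i ⁆)
      rL[X+i]<g[X+i] = subst (_< g (X ∪ ⁅ i ⁆)) (sym rL[X+i]≡f) (<-≤-trans f<g (g-mono (p⊆p∪q _)))
    cl⊆ : cl L X ⊆ cl (rk M) (X ∩ A) ∪ X
    cl⊆ {i} i∈cl with i ∈? X
    ... | yes i∈X = q⊆p∪q _ X i∈X
    ... | no i∉X = p⊆p∪q X (f-∪⁅⁆≡f⇒∈cl-M i∉X (f-stable (proj₂ (∈cl⁻ L X i∈cl))))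
    M-cl⊆ : cl (rk M) (X ∩ A) ⊆ cl L X
    M-cl⊆ {i} i∈M-cl = rL-∪⁅⁆≤⇒∈cl X⊆EL (p⊆p∪q B (cl⊆E (rk M) (X ∩ A) i∈M-cl))
      (≤-trans (rL≤f (X ∪ ⁅ i ⁆)) (≤-reflexive (trans (∈cl-M⇒f-∪⁅⁆≡f i∈M-cl) (sym rL≡f))))

  splice-cl-≮ : ∀ {X} → X ⊆ EL → ¬ f X < g X → cl L X ≡ cl (rk N) (X ∩ B) ∪ S
  splice-cl-≮ {X} X⊆EL f≮g = ⊆-antisym cl⊆ (∪-lub N-cl⊆ S⊆cl)
    where
    rL≡g : rL X ≡ g X
    rL≡g = g≤f⇒rL≡g (≮⇒≥ f≮g)
    N-spans : ∀ {i} → i ∈ B → Spans L X i → Spans (rk N) (X ∩ B) i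
    N-spans {i} i∈B L-spans with i ∈? X | g (X ∪ ⁅ i ⁆) ≤? f (X ∪ ⁅ i ⁆)
    ... | yes i∈X | _ = cong rN (x∈p⇒p∪⁅x⁆≡p (x∈p∩q⁺ (i∈X , i∈B)))
    ... | no _ | yes g≤f = +-cancelˡ-≡ s _ _
      (trans (sym (g-∪⁅⁆-∈B X i∈B)) (trans (sym (g≤f⇒rL≡g g≤f)) (trans L-spans rL≡g)))
    ... | no i∉X | no g≰f = ∈cl-M⇒spans-N i∈B (f-∪⁅⁆≡f⇒∈cl-M i∉X f[X+i]≡f)
      where
      f[X+i]≡g : f (X ∪ ⁅ i ⁆) ≡ g X
      f[X+i]≡g = trans (sym (f≤g⇒rL≡f (<⇒≤ (≰⇒> g≰f)))) (trans L-spans rL≡g)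
      f[X+i]≡f : f (X ∪ ⁅ i ⁆) ≡ f X
      f[X+i]≡f = ≤-antisym (≤-trans (≤-reflexive f[X+i]≡g) (≮⇒≥ f≮g)) (f-mono (p⊆p∪q _))
    cl⊆ : cl L X ⊆ cl (rk N) (X ∩ B) ∪ S
    cl⊆ {i} i∈cl with ∈cl⁻ L X i∈cl | i ∈? B
    ... | _ , L-spans | yes i∈B = p⊆p∪q S (∈cl⁺ (rk N) (X ∩ B) i∈B (N-spans i∈B L-spans))
    ... | i∈EL , _ | no i∉B = q⊆p∪q _ S (x∈p∧x∉q⇒x∈p─q (x∈p∪q∧x∉q⇒x∈p A B i∈EL i∉B) i∉B)
    N-cl⊆ : cl (rk N) (X ∩ B) ⊆ cl L X
    N-cl⊆ {i} i∈N-cl with ∈cl⁻ (rk N) (X ∩ B) i∈N-cl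
    ... | i∈B , N-spans = rL-∪⁅⁆≤⇒∈cl X⊆EL (q⊆p∪q A B i∈B)
      (≤-trans (rL≤g (X ∪ ⁅ i ⁆)) (≤-reflexive (trans (g-∪⁅⁆-∈B X i∈B) (trans (cong (s +_) N-spans) (sym rL≡g)))))
    S⊆cl : S ⊆ cl L X
    S⊆cl {i} i∈S with x∈p─q⁻ A B i∈S
    ... | i∈A , i∉B = rL-∪⁅⁆≤⇒∈cl X⊆EL (p⊆p∪q B i∈A)
      (≤-trans (rL≤g (X ∪ ⁅ i ⁆)) (≤-reflexive (trans (g-∪⁅⁆-∉B X i∉B) (sym rL≡g))))

  flat-L-<⇒flat-M : ∀ {X} → Flat L X → f X < g X → Flat (rk M) (X ∩ A)
  flat-L-<⇒flat-M {X} (X⊆EL , cl≡X) f<g =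
    cl⊆⇒flat (rk M) (p∩q⊆q X A) (∩-glb (subst (cl (rk M) (X ∩ A) ⊆_) cl∪X≡X (p⊆p∪q X)) (cl⊆E (rk M) (X ∩ A)))
    where
    cl∪X≡X : cl (rk M) (X ∩ A) ∪ X ≡ X
    cl∪X≡X = trans (sym (splice-cl-< X⊆EL f<g)) cl≡X

  flat-L-≮⇒flat-N : ∀ {X} → Flat L X → ¬ f X < g X → Flat (rk N) (X ∩ B) × X ≡ S ∪ (X ∩ B)
  flat-L-≮⇒flat-N {X} (X⊆EL , cl≡X) f≮g =
    X∩B-flat , trans (sym cl∪S≡X) (trans (cong (_∪ S) (proj₂ X∩B-flat)) (∪-comm (X ∩ B) S))
    where
    cl∪S≡X : cl (rk N) (X ∩ B) ∪ S ≡ X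
    cl∪S≡X = trans (sym (splice-cl-≮ X⊆EL f≮g)) cl≡X
    X∩B-flat : Flat (rk N) (X ∩ B)
    X∩B-flat =
      cl⊆⇒flat (rk N) (p∩q⊆q X B) (∩-glb (subst (cl (rk N) (X ∩ B) ⊆_) cl∪S≡X (p⊆p∪q S)) (cl⊆E (rk N) (X ∩ B)))

  flat-M⇒flat-L : ∀ {X} → X ⊆ EL → Flat (rk M) (X ∩ A) → f X < g X → Flat L X
  flat-M⇒flat-L {X} X⊆EL (_ , cl≡X∩A) f<g =
    X⊆EL , trans (splice-cl-< X⊆EL f<g)
                 (trans (cong (_∪ X) cl≡X∩A) (⊆-antisym (∪-lub (p∩q⊆p X A) ⊆-refl) (q⊆p∪q (X ∩ A) X)))

  flat-N⇒flat-L : ∀ {F} → Flat (rk N) F → Flat L (S ∪ F)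
  flat-N⇒flat-L {F} (F⊆B , cl≡F) = X⊆EL , (begin
    cl L X                   ≡⟨ splice-cl-≮ X⊆EL (≤⇒≯ (S⊆X⇒g≤f X⊆EL (p⊆p∪q F))) ⟩
    cl (rk N) (X ∩ B) ∪ S    ≡⟨ cong (λ U → cl (rk N) U ∪ S) X∩B≡F ⟩
    cl (rk N) F ∪ S          ≡⟨ cong (_∪ S) cl≡F ⟩
    F ∪ S                    ≡⟨ ∪-comm F S ⟩
    S ∪ F                    ∎)
    where
    open ≡-Reasoning
    X : Subset n
    X = S ∪ F
    X⊆EL : X ⊆ EL
    X⊆EL = ∪-lub (p⊆p∪q B ∘ S⊆A) (q⊆p∪q A B ∘ F⊆B)
    X∩B≡F : X ∩ B ≡ F
    X∩B≡F = trans (set-≡ (((v₀ ─ᵉ v₁) ∪ᵉ v₂) ∩ᵉ v₁) (v₂ ∩ᵉ v₁) refl (A ∷ B ∷ F ∷ [])) (p⊆q⇒p∩q≡p F⊆B)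

  FlatCases : Subset n → Set
  FlatCases X = (X ⊆ EL × Flat (rk M) (X ∩ A) × f X < g X) ⊎ Σ (Subset n) λ F → Flat (rk N) F × X ≡ S ∪ F

  splice-flat⇔ : ∀ X → Flat L X ⇔ FlatCases X
  splice-flat⇔ X = mk⇔ to from
    where
    to : Flat L X → FlatCases X
    to X-flat with f X <? g X
    ... | yes f<g = inj₁ (proj₁ X-flat , flat-L-<⇒flat-M X-flat f<g , f<g)
    ... | no f≮g = inj₂ (X ∩ B , flat-L-≮⇒flat-N X-flat f≮g)
    from : FlatCases X → Flat L X
    from (inj₁ (X⊆EL , X∩A-flat , f<g)) = flat-M⇒flat-L X⊆EL X∩A-flat f<g
    from (inj₂ (F , F-flat , refl)) = flat-N⇒flat-L F-flat

  cyclic-on-A⇔ : ∀ {Z} → Z ⊆ A → Cyclic L Z ⇔ Cyclic (rk M) Z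
  cyclic-on-A⇔ {Z} Z⊆A = mk⇔
    (λ L-cyclic e e∈Z → trans (sym (rL-on-A (Z⊆A ∘ p─q⊆p Z ⁅ e ⁆))) (trans (L-cyclic e e∈Z) (rL-on-A Z⊆A)))
    (λ M-cyclic e e∈Z → trans (rL-on-A (Z⊆A ∘ p─q⊆p Z ⁅ e ⁆)) (trans (M-cyclic e e∈Z) (sym (rL-on-A Z⊆A))))

  spans-M⇒spans-L : ∀ {Y i} → Y ⊆ A → i ∈ A → Spans (rk M) Y i → Spans L Y i
  spans-M⇒spans-L Y⊆A i∈A M-spans =
    trans (rL-on-A (∪-lub Y⊆A (x∈p⇒⁅x⁆⊆p i∈A))) (trans M-spans (sym (rL-on-A Y⊆A)))

  flat-L⊆A⇒flat-M : ∀ {Z} → Z ⊆ A → Flat L Z → Flat (rk M) Z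
  flat-L⊆A⇒flat-M {Z} Z⊆A (_ , cl≡Z) = cl⊆⇒flat (rk M) Z⊆A M-cl⊆Z
    where
    M-cl⊆Z : cl (rk M) Z ⊆ Z
    M-cl⊆Z {i} i∈cl with ∈cl⁻ (rk M) Z i∈cl
    ... | i∈A , M-spans = subst (i ∈_) cl≡Z (∈cl⁺ L Z (p⊆p∪q B i∈A) (spans-M⇒spans-L Z⊆A i∈A M-spans))

  cyclicFlat-L⊆A⇒cyclicFlat-M : ∀ {Z} → Z ⊆ A → Flat L Z → Cyclic L Z → CyclicFlat (rk M) Z
  cyclicFlat-L⊆A⇒cyclicFlat-M Z⊆A Z-flat L-cyclic =
    Equivalence.from M′.cyclicFlat⇔ (flat-L⊆A⇒flat-M Z⊆A Z-flat , Equivalence.to (cyclic-on-A⇔ Z⊆A) L-cyclic)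

  f-∪⁅⁆≤ : ∀ X i → f (X ∪ ⁅ i ⁆) ≤ suc (f X)
  f-∪⁅⁆≤ X i = begin
    f (X ∪ ⁅ i ⁆)                      ≤⟨ m≤m+n _ _ ⟩
    f (X ∪ ⁅ i ⁆) + f (X ∩ ⁅ i ⁆)      ≤⟨ f-submodular X ⁅ i ⁆ ⟩
    f X + f ⁅ i ⁆                      ≤⟨ +-monoʳ-≤ (f X) (f-bound ⁅ i ⁆) ⟩
    f X + ∣ ⁅ i ⁆ ∣                    ≡⟨ trans (cong (f X +_) (∣⁅x⁆∣≡1 i)) (+-comm (f X) 1) ⟩
    suc (f X)                          ∎
    where open ≤-Reasoning

  cyclic-L∧f<g⇒⊆A : ∀ {Z} → Cyclic L Z → f Z < g Z → Z ⊆ A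
  cyclic-L∧f<g⇒⊆A {Z} L-cyclic f<g {e} e∈Z with e ∈? A
  ... | yes e∈A = e∈A
  ... | no e∉A = contradiction (begin-strict
    f Z                   ≡⟨ f≤g⇒rL≡f (<⇒≤ f<g) ⟨
    rL Z                  ≡⟨ L-cyclic e e∈Z ⟨
    rL (Z - e)            ≤⟨ rL≤f (Z - e) ⟩
    f (Z - e)             <⟨ n<1+n _ ⟩
    suc (f (Z - e))       ≡⟨ f-∪⁅⁆-∉A (Z - e) e∉A x∉p-x ⟨
    f ((Z - e) ∪ ⁅ e ⁆)   ≡⟨ cong f (x∈p⇒p-x∪⁅x⁆≡p e∈Z) ⟩
    f Z                   ∎) (<-irrefl refl)
    where open ≤-Reasoning

  cyclic-L∧f≮g⇒cyclic-N : ∀ {Z} → Cyclic L Z → ¬ f Z < g Z → Cyclic (rk N) (Z ∩ B)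
  cyclic-L∧f≮g⇒cyclic-N {Z} L-cyclic f≮g e e∈Z∩B =
    ≤-antisym (N′.ρ-mono (p─q⊆p (Z ∩ B) ⁅ e ⁆) (p∩q⊆q Z B)) (+-cancelˡ-≤ s _ _ (begin
      g Z                    ≡⟨ g≤f⇒rL≡g (≮⇒≥ f≮g) ⟨
      rL Z                   ≡⟨ L-cyclic e (p∩q⊆p Z B e∈Z∩B) ⟨
      rL (Z - e)             ≤⟨ rL≤g (Z - e) ⟩
      g (Z - e)              ≡⟨ cong (λ U → s + rN U) ([X-e]∩B≡[X∩B]-e Z e) ⟩
      s + rN ((Z ∩ B) - e)   ∎))
    where open ≤-Reasoning

  S⊆Z⇒Z≡S∪[Z∩B] : ∀ {Z} → Z ⊆ EL → S ⊆ Z → Z ≡ S ∪ Z ∩ B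
  S⊆Z⇒Z≡S∪[Z∩B] {Z} Z⊆EL S⊆Z = ⊆-antisym
    (set-⊆ (v₀ ∩ᵉ (v₁ ∪ᵉ v₂)) ((v₁ ─ᵉ v₂) ∪ᵉ v₀ ∩ᵉ v₂) refl (Z ∷ A ∷ B ∷ []) ∘ ∩-glb ⊆-refl Z⊆EL)
    (∪-lub S⊆Z (p∩q⊆p Z B))

  S⊆Z⇒flat-L : ∀ {Z} → Z ⊆ EL → S ⊆ Z → Flat (rk N) (Z ∩ B) → Flat L Z
  S⊆Z⇒flat-L {Z} Z⊆EL S⊆Z Z∩B-flat = subst (Flat L) (sym (S⊆Z⇒Z≡S∪[Z∩B] Z⊆EL S⊆Z)) (flat-N⇒flat-L Z∩B-flat)

  1+g≤f : ∀ {Z} → Z ⊆ EL → S ⊆ Z → ¬ Z ⊆ A → Cyclic (rk N) (Z ∩ B) → suc (g Z) ≤ f Z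
  1+g≤f {Z} Z⊆EL S⊆Z Z⊈A N-cyclic with ⊈⇒∃ Z⊈A
  ... | x , x∈Z , x∉A = begin
    suc (s + rN (Z ∩ B))                         ≡⟨ +-suc s (rN (Z ∩ B)) ⟨
    s + suc (rN (Z ∩ B))                         ≤⟨ +-monoʳ-≤ s (N′.ρ-del≡ρ⇒ρ<ρ+∣─∣ (p∩q⊆q Z B) T⊆B x∈Z∩B
                                                      (x∉A ∘ p∩q⊆p A B ∘ p∩q⊆q Z (A ∩ B)) (N-cyclic x x∈Z∩B)) ⟩
    s + (rN (Z ∩ A ∩ B) + ∣ Z ∩ B ─ Z ∩ A ∩ B ∣) ≤⟨ +-monoʳ-≤ s (+-monoʳ-≤ (rN (Z ∩ A ∩ B)) (p⊆q⇒∣p∣≤∣q∣ Z∩B─T⊆Z─A)) ⟩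
    s + (rN (Z ∩ A ∩ B) + ∣ Z ─ A ∣)             ≡⟨ S⊆X⇒f≡ S⊆Z ⟨
    f Z                                          ∎
    where
    open ≤-Reasoning
    x∈Z∩B : x ∈ Z ∩ B
    x∈Z∩B = x∈p∩q⁺ (x∈Z , x∈p∪q∧x∉q⇒x∈p B A (subst (x ∈_) (∪-comm A B) (Z⊆EL x∈Z)) x∉A)
    Z∩B─T⊆Z─A : Z ∩ B ─ Z ∩ A ∩ B ⊆ Z ─ A
    Z∩B─T⊆Z─A = set-⊆ (v₀ ∩ᵉ v₂ ─ᵉ v₀ ∩ᵉ v₁ ∩ᵉ v₂) (v₀ ─ᵉ v₁) refl (Z ∷ A ∷ B ∷ [])
    T⊆B : Z ∩ A ∩ B ⊆ B
    T⊆B = p∩q⊆q A B ∘ p∩q⊆q Z (A ∩ B)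

  cyclic-N⇒cyclic-L : ∀ {Z} → Z ⊆ EL → S ⊆ Z → ¬ Z ⊆ A → Cyclic (rk N) (Z ∩ B) → Cyclic L Z
  cyclic-N⇒cyclic-L {Z} Z⊆EL S⊆Z Z⊈A N-cyclic e e∈Z = begin
    rL (Z - e)   ≡⟨ g≤f⇒rL≡g (subst (_≤ f (Z - e)) (sym g[Z-e]≡g) g≤f[Z-e]) ⟩
    g (Z - e)    ≡⟨ g[Z-e]≡g ⟩
    g Z          ≡⟨ S⊆X⇒rL≡g Z⊆EL S⊆Z ⟨
    rL Z         ∎
    where
    open ≡-Reasoning
    g[Z-e]≡g : g (Z - e) ≡ g Z
    g[Z-e]≡g with e ∈? B
    ... | yes e∈B = cong (s +_) (trans (cong rN ([X-e]∩B≡[X∩B]-e Z e)) (N-cyclic e (x∈p∩q⁺ (e∈Z , e∈B))))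
    ... | no e∉B = cong (λ U → s + rN U) (trans ([X-e]∩B≡[X∩B]-e Z e) (x∉p⇒p-x≡p (e∉B ∘ p∩q⊆q Z B)))
    g≤f[Z-e] : g Z ≤ f (Z - e)
    g≤f[Z-e] = ≤-pred (≤-trans (1+g≤f Z⊆EL S⊆Z Z⊈A N-cyclic)
                               (≤-trans (≤-reflexive (cong f (sym (x∈p⇒p-x∪⁅x⁆≡p e∈Z)))) (f-∪⁅⁆≤ (Z - e) e)))

  flat-M∧S⊈⇒f<g : ∀ {Z} → Flat (rk M) Z → ¬ S ⊆ Z → f Z < g Z
  flat-M∧S⊈⇒f<g {Z} (Z⊆A , cl≡Z) S⊈Z with ⊈⇒∃ S⊈Z
  ... | e , e∈S , e∉Z = begin-strict
    f Z               ≡⟨ f-on-A Z⊆A ⟩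
    rM Z              <⟨ ≤∧≢⇒< (M′.ρ-mono (p⊆p∪q _) Z+e⊆A) (e∉Z ∘ subst (e ∈_) cl≡Z ∘ ∈cl⁺ (rk M) Z e∈A ∘ sym) ⟩
    rM (Z ∪ ⁅ e ⁆)    ≤⟨ rM≤g Z+e⊆A ⟩
    g (Z ∪ ⁅ e ⁆)     ≡⟨ g-∪⁅⁆-∉B Z (proj₂ (x∈p─q⁻ A B e∈S)) ⟩
    g Z               ∎
    where
    open ≤-Reasoning
    e∈A : e ∈ A
    e∈A = S⊆A e∈S
    Z+e⊆A : Z ∪ ⁅ e ⁆ ⊆ A
    Z+e⊆A = ∪-lub Z⊆A (x∈p⇒⁅x⁆⊆p e∈A)

  CyclicFlatCases : Subset n → Set
  CyclicFlatCases Z = (CyclicFlat (rk M) Z × ¬ S ⊆ Z)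
                    ⊎ (CyclicFlat (rk M) Z × S ⊆ Z × CyclicFlat (rk N) (Z ∩ B))
                    ⊎ (Z ⊆ EL × S ⊆ Z × ¬ Z ⊆ A × CyclicFlat (rk N) (Z ∩ B))

  splice-cyclicFlat⇔ : ∀ Z → CyclicFlat L Z ⇔ CyclicFlatCases Z
  splice-cyclicFlat⇔ Z = mk⇔ to from
    where
    to : CyclicFlat L Z → CyclicFlatCases Z
    to Z-cf with Equivalence.to L′.cyclicFlat⇔ Z-cf | f Z <? g Z
    ... | Z-flat , L-cyclic | yes f<g =
      inj₁ (cyclicFlat-L⊆A⇒cyclicFlat-M Z⊆A Z-flat L-cyclic , λ S⊆Z → ≤⇒≯ (S⊆X⇒g≤f (proj₁ Z-flat) S⊆Z) f<g)
      where
      Z⊆A : Z ⊆ A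
      Z⊆A = cyclic-L∧f<g⇒⊆A L-cyclic f<g
    ... | Z-flat , L-cyclic | no f≮g with flat-L-≮⇒flat-N Z-flat f≮g | Z ⊆? A
    ...   | Z∩B-flat , Z≡S∪Z∩B | Z⊆A? = classify Z⊆A?
      where
      S⊆Z : S ⊆ Z
      S⊆Z = subst (S ⊆_) (sym Z≡S∪Z∩B) (p⊆p∪q _)
      Z∩B-cf : CyclicFlat (rk N) (Z ∩ B)
      Z∩B-cf = Equivalence.from N′.cyclicFlat⇔ (Z∩B-flat , cyclic-L∧f≮g⇒cyclic-N L-cyclic f≮g)
      classify : Dec (Z ⊆ A) → CyclicFlatCases Z
      classify (yes Z⊆A) = inj₂ (inj₁ (cyclicFlat-L⊆A⇒cyclicFlat-M Z⊆A Z-flat L-cyclic , S⊆Z , Z∩B-cf))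
      classify (no Z⊈A) = inj₂ (inj₂ (proj₁ Z-flat , S⊆Z , Z⊈A , Z∩B-cf))
    from : CyclicFlatCases Z → CyclicFlat L Z
    from (inj₁ (Z-M-cf , S⊈Z)) with Equivalence.to M′.cyclicFlat⇔ Z-M-cf
    ... | Z-M-flat@(Z⊆A , _) , M-cyclic = Equivalence.from L′.cyclicFlat⇔
      ( flat-M⇒flat-L (p⊆p∪q B ∘ Z⊆A) (subst (Flat (rk M)) (sym (p⊆q⇒p∩q≡p Z⊆A)) Z-M-flat)
                      (flat-M∧S⊈⇒f<g Z-M-flat S⊈Z)
      , Equivalence.from (cyclic-on-A⇔ Z⊆A) M-cyclic)
    from (inj₂ (inj₁ (Z-M-cf , S⊆Z , Z∩B-cf))) with Equivalence.to M′.cyclicFlat⇔ Z-M-cf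
    ... | (Z⊆A , _) , M-cyclic = Equivalence.from L′.cyclicFlat⇔
      ( S⊆Z⇒flat-L (p⊆p∪q B ∘ Z⊆A) S⊆Z (proj₁ (Equivalence.to N′.cyclicFlat⇔ Z∩B-cf))
      , Equivalence.from (cyclic-on-A⇔ Z⊆A) M-cyclic)
    from (inj₂ (inj₂ (Z⊆EL , S⊆Z , Z⊈A , Z∩B-cf))) with Equivalence.to N′.cyclicFlat⇔ Z∩B-cf
    ... | Z∩B-flat , N-cyclic = Equivalence.from L′.cyclicFlat⇔
      (S⊆Z⇒flat-L Z⊆EL S⊆Z Z∩B-flat , cyclic-N⇒cyclic-L Z⊆EL S⊆Z Z⊈A N-cyclic)

theorem3p10 : ∀ {n} (M N : Matroid n) → Matched M N →
    let A = E (rk M)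
        B = E (rk N)
        L = splice M N
        EL = A ∪ B
        S = A ─ B
        rM = r (rk M)
        rN = r (rk N)
        rr = rM S + rank (rk N)
    in (rank L ≡ rr)
     × (∀ X → Indep L X ⇔ (X ⊆ EL × Indep (rk M) (X ∩ A) × ∣ X ∣ ≤ rM S + rN (X ∩ B)))
     × (∀ X → Spanning L X ⇔ (X ⊆ EL × Spanning (rk N) (X ∩ B) × rM (X ∩ A) + ∣ X ─ A ∣ ≥ rr))
     × (∀ X → Basis L X ⇔ (X ⊆ EL × ∣ X ∣ ≡ rr × Indep (rk M) (X ∩ A) × Spanning (rk N) (X ∩ B)))
     × (∀ X → Circuit L X ⇔ (Circuit (rk M) X
          ⊎ (X ⊆ EL × Indep (rk M) (X ∩ A) × NoIsthmus (rk N) (X ∩ B)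
             × rN (X ∩ B) + rM S + 1 ≡ ∣ X ∣)))
     × (∀ X → X ⊆ EL →
          (rM (X ∩ A) + ∣ X ─ A ∣ < rM S + rN (X ∩ B) → cl L X ≡ cl (rk M) (X ∩ A) ∪ X)
        × (¬ (rM (X ∩ A) + ∣ X ─ A ∣ < rM S + rN (X ∩ B)) → cl L X ≡ cl (rk N) (X ∩ B) ∪ S))
     × (∀ X → Flat L X ⇔
          ((X ⊆ EL × Flat (rk M) (X ∩ A) × rM (X ∩ A) + ∣ X ─ A ∣ < rM S + rN (X ∩ B))
          ⊎ Σ (Subset n) (λ F → Flat (rk N) F × X ≡ S ∪ F)))
     × (∀ Z → CyclicFlat L Z ⇔
          ((CyclicFlat (rk M) Z × ¬ (S ⊆ Z))
          ⊎ (CyclicFlat (rk M) Z × S ⊆ Z × CyclicFlat (rk N) (Z ∩ B))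
          ⊎ (Z ⊆ EL × S ⊆ Z × ¬ (Z ⊆ A) × CyclicFlat (rk N) (Z ∩ B))))
theorem3p10 M N matched =
  splice-rank ,
  splice-indep⇔ ,
  splice-spanning⇔ ,
  splice-basis⇔ ,
  splice-circuit⇔ ,
  (λ X X⊆EL → splice-cl-< X⊆EL , splice-cl-≮ X⊆EL) ,
  splice-flat⇔ ,
  splice-cyclicFlat⇔
  where open FreeSplice M N matched
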